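{- For $n \geq 1$ and $k \geq 0$ let $d_{n,k}$ be the number of labelled threshold graphs $G$ on vertex set $[n]$ with $d(G)=k$. Then $d_{n,0}=1$ for all $n\geq 1$, $d_{2,1}=1$, $d_{2,k}=0$ for all $k \geq 2$, and for all $n \geq 3$ and $k \geq 1$, $$d_{n,k} = \sum_{\ell \geq 1} \binom{n}{k+1}O_2(k+1,\ell)\Big[(\ell-1)!\,S(n-k-1,\ell-1) + \ell!\,S(n-k-1,\ell)\Big] + \sum_{\ell \geq 1} \binom{n}{k}\ell!\,S(k,\ell)\Big[O_2(n-k,\ell+1) + O_2(n-k,\ell)\Big].$$
   Context: A (simple, finite) graph is a threshold graph if it belongs to the smallest family of graphs containing the one-vertex graph $K_1$ and closed under adding an isolated vertex and adding a dominating vertex (a new vertex adjacent to all existing vertices). A labelled threshold graph on $[n]=\{1,\ldots,n\}$ is a threshold graph with vertex set $[n]$ (distinct edge sets give distinct graphs). Every threshold graph $G$ can be built from a single initial vertex by successively adding isolated or dominating vertices; the number of dominating vertices added in such a construction (the initial vertex is not counted as dominating) does not depend on the construction chosen, and is denoted $d(G)$. $S(m,j)$ is the Stirling number of the second kind (number of partitions of an $m$-set into $j$ non-empty blocks), with $S(0,0)=1$ and $S(m,0)=0$ for $m\geq1$. $O_2(m,\ell)$ is the number of ordered partitions of $[m]$ into $\ell$ non-empty blocks whose first block has size at least $2$ (this is $0$ if no such partition exists). -}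

module Defs where

open import Data.Nat using (ℕ; zero; suc; _+_; _*_; _∸_; _<ᵇ_; _≤ᵇ_; _≡ᵇ_)
open import Data.Nat using (_!)
open import Data.Nat.Combinatorics using (_C_)
open import Data.Bool using (Bool; true; false; if_then_else_; _∧_; not)
open import Data.Fin using (Fin; toℕ)
open import Data.Fin.Permutation using (Permutation′; _⟨$⟩ˡ_)
open import Data.List using (List; []; _∷_; length; map; concatMap; allFin; upTo)
open import Data.Nat.ListAction using (sum)
open import Data.List.Relation.Unary.Unique.Propositional using (Unique)
open import Data.List.Membership.Propositional using (_∈_)
open import Data.Vec using (Vec; tabulate)
import Data.Vec as V
open import Data.Product using (Σ; _×_; ∃)
open import Function.Bundles using (_⇔_)
open import Relation.Binary.PropositionalEquality using (_≡_)

-- Graphs on vertex set [n] = Fin n, given by their adjacency matrix.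
-- (Matrices are Vecs, so propositional equality is equality of edge sets.)

Graph : ℕ → Set
Graph n = Vec (Vec Bool n) n

-- A construction sequence of a threshold graph on [n]:
--   * σ : positions → vertices  (σ ⟨$⟩ʳ 0 is the initial vertex, σ ⟨$⟩ʳ p is
--     the vertex added at step p),
--   * t : Fin n → Bool, t p = true iff the vertex added at step p (p ≥ 1) is
--     dominating (added adjacent to all earlier vertices), false iff isolated.
--     The value t 0 (initial vertex) is irrelevant.

adjPos : ∀ {n} → (Fin n → Bool) → Fin n → Fin n → Bool
adjPos t i j =
  if toℕ i <ᵇ toℕ j then t j
  else (if toℕ j <ᵇ toℕ i then t i else false)

buildGraph : ∀ {n} → Permutation′ n → (Fin n → Bool) → Graph n
buildGraph σ t = tabulate λ u → tabulate λ v → adjPos t (σ ⟨$⟩ˡ u) (σ ⟨$⟩ˡ v)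

boolCount : {A : Set} → (A → Bool) → List A → ℕ
boolCount p [] = 0
boolCount p (x ∷ xs) = (if p x then 1 else 0) + boolCount p xs

domCount : ∀ {n} → (Fin n → Bool) → ℕ
domCount {n} t = boolCount (λ p → t p ∧ not (toℕ p ≡ᵇ 0)) (allFin n)

-- G is a (labelled) threshold graph on [n] with d(G) = k:
-- G arises from some construction sequence with exactly k dominating additions.
-- (d(G) is independent of the construction, so this is well defined.)
ThresholdWithD : (n k : ℕ) → Graph n → Set
ThresholdWithD n k G =
  Σ (Permutation′ n) λ σ → Σ (Fin n → Bool) λ t →
    (buildGraph σ t ≡ G) × (domCount t ≡ k)

-- "The number of x : A with P x is N": a duplicate-free list of length N
-- whose members are exactly the x satisfying P.
HasCount : {A : Set} → (A → Set) → ℕ → Set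
HasCount {A} P N =
  Σ (List A) λ xs → Unique xs × (length xs ≡ N) × (∀ x → (x ∈ xs) ⇔ P x)

S : ℕ → ℕ → ℕ
S zero zero = 1
S zero (suc j) = 0
S (suc m) zero = 0
S (suc m) (suc j) = suc j * S m (suc j) + S m j

-- O₂(m, ℓ): ordered partitions of [m] into ℓ non-empty blocks whose first
-- block has size ≥ 2.  An ordered partition (B₀,…,B_{ℓ-1}) of [m] is the
-- same thing as a surjection f : [m] → [ℓ] (Bᵢ = f⁻¹(i)); we count these
-- by explicit enumeration of all functions [m] → [ℓ] (as vectors).

allFuns : (m ℓ : ℕ) → List (Vec (Fin ℓ) m)
allFuns zero ℓ = V.[] ∷ []
allFuns (suc m) ℓ = concatMap (λ i → map (i V.∷_) (allFuns m ℓ)) (allFin ℓ)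

occ : ∀ {m ℓ} → Fin ℓ → Vec (Fin ℓ) m → ℕ
occ b V.[] = 0
occ b (x V.∷ xs) = (if toℕ x ≡ᵇ toℕ b then 1 else 0) + occ b xs

allB : {A : Set} → (A → Bool) → List A → Bool
allB p [] = true
allB p (x ∷ xs) = p x ∧ allB p xs

isO₂ : ∀ {m ℓ} → Fin (suc ℓ) → Vec (Fin (suc ℓ)) m → Bool
isO₂ {ℓ = ℓ} first f =
  allB (λ b → 1 ≤ᵇ occ b f) (allFin (suc ℓ)) ∧ (2 ≤ᵇ occ first f)

O₂ : ℕ → ℕ → ℕ
O₂ m zero = 0
O₂ m (suc ℓ) = boolCount (isO₂ Fin.zero) (allFuns m (suc ℓ))
  where import Data.Fin as Fin

-- The right-hand side of the formula for d_{n,k} (n ≥ 3, k ≥ 1).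
-- The sums over ℓ ≥ 1 are finite: O₂(k+1,ℓ) = 0 for ℓ > k+1 and
-- S(k,ℓ) = 0 for ℓ > k, so summing ℓ = 1, …, n+k+1 loses nothing.

term1 : ℕ → ℕ → ℕ → ℕ
term1 n k ℓ =
  (n C (k + 1)) * O₂ (k + 1) ℓ *
    (((ℓ ∸ 1) !) * S (n ∸ k ∸ 1) (ℓ ∸ 1) + (ℓ !) * S (n ∸ k ∸ 1) ℓ)

term2 : ℕ → ℕ → ℕ → ℕ
term2 n k ℓ =
  (n C k) * (ℓ !) * S k ℓ * (O₂ (n ∸ k) (ℓ + 1) + O₂ (n ∸ k) ℓ)

formula : ℕ → ℕ → ℕ
formula n k =
  sum (map (λ i → term1 n k (suc i)) (upTo (n + k + 1)))
  + sum (map (λ i → term2 n k (suc i)) (upTo (n + k + 1)))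

-- A threshold graph G on n ≥ 2 vertices is determined by its levels: cut a construction sequence
-- into maximal runs of additions of equal kind (the initial vertex joins the first run); two
-- distinct vertices are adjacent iff the higher of their levels is dominating. Levels alternate in
-- kind, so G amounts to the kind of level 0 together with an ordered partition of the vertices on
-- dominating levels and one of the vertices on isolated levels, interleaved, where the block of
-- level 0 has at least two vertices. Conversely G determines its levels: if u and v lie on
-- different levels, some third vertex is adjacent to exactly one of them. Every vertex on a
-- dominating level except the initial one counts towards d(G). So if level 0 is dominating, choose
-- the k + 1 vertices on dominating levels, an ordered partition of them into ℓ blocks with first
-- block of size ≥ 2, and one of the remaining vertices into ℓ - 1 or ℓ blocks; if level 0 is
-- isolated, choose the k dominating vertices, an ordered partition of them into ℓ blocks, and one
-- of the remaining vertices into ℓ + 1 or ℓ blocks with first block of size ≥ 2.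

module Submission where

open import Defs

import Algebra.Properties.CommutativeMonoid.Sum as CommutativeMonoidSum
open import Data.Bool using (Bool; true; false; if_then_else_; _∧_; _∨_; not; _xor_; T?)
open import Data.Bool.Properties using (not-¬; not-involutive; ∧-zeroʳ; ∧-identityʳ; ∧-assoc; ∧-comm; T-≡)
open import Data.Fin using (Fin; zero; suc; toℕ; punchIn; punchOut; fromℕ<; _≟_)
open import Data.Fin.Properties
  using (punchIn-injective; punchInᵢ≢i; punchOut-injective; toℕ-injective; toℕ<n; toℕ-fromℕ<; injective⇒≤; any?)
import Data.Fin.Properties as Finₚ
open import Data.Fin.Permutation using (Permutation′; _⟨$⟩ʳ_; _⟨$⟩ˡ_; permutation; inverseˡ; inverseʳ)
import Data.Fin.Permutation as Permutation
open import Data.List using (List; []; _∷_; length; map; concatMap; allFin; _++_; tabulate; filterᵇ; upTo)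
open import Data.List.Membership.Propositional using (_∈_; find; lose)
open import Data.List.Membership.Propositional.Properties
  using (∈-map⁺; ∈-map⁻; ∈-concatMap⁺; ∈-concatMap⁻; ∈-filter⁺; ∈-filter⁻; ∈-++⁺ˡ; ∈-++⁺ʳ)
open import Data.List.Membership.Propositional.Properties using (∈-allFin; ∈-upTo⁺)
open import Data.List.Properties using (map-++; map-∘; map-cong; length-++; length-map)
open import Data.List.Relation.Unary.All using ([]; _∷_)
import Data.List.Relation.Unary.All as All
open import Data.List.Relation.Unary.AllPairs using ([]; _∷_)
open import Data.List.Relation.Unary.Any using (here; there)
open import Data.List.Relation.Unary.Unique.Propositional using (Unique)
open import Data.List.Relation.Unary.Unique.Propositional.Properties using (++⁺; map⁺; filter⁺; allFin⁺; upTo⁺)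
open import Data.Nat
  using (ℕ; zero; suc; _+_; _*_; _∸_; _⊔_; _≤_; _<_; z≤n; s≤s; s≤s⁻¹; z<s; _≤?_; _<?_; _≡ᵇ_; _≤ᵇ_; _<ᵇ_; _!)
open import Data.Nat.Combinatorics using (_C_; nCk+nC[k+1]≡[n+1]C[k+1]; k>n⇒nCk≡0)
open import Data.Nat.ListAction using (sum)
open import Data.Nat.ListAction.Properties using (sum-++)
open import Data.Nat.Properties hiding (_≟_)
open import Data.Nat.Solver using (module +-*-Solver)
open import Data.Product using (Σ; _×_; _,_; proj₁; proj₂)
open import Data.Sum using (_⊎_; inj₁; inj₂; swap)
import Data.Sum as Sum
open import Data.Sum.Properties using (swap-involutive; inj₁-injective; inj₂-injective)
open import Data.Vec using (Vec; lookup; toList)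
import Data.Vec as V
open import Data.Vec.Properties using (lookup∘tabulate; tabulate-cong; tabulate∘lookup; ∷-injectiveˡ; ∷-injectiveʳ)
open import Function using (_∘_; _∋_)
open import Function.Bundles using (Equivalence; mk⇔)
open import Relation.Binary.Definitions using (tri<; tri≈; tri>)
open import Relation.Binary.PropositionalEquality
open import Relation.Nullary using (¬_; contradiction; yes; no)

open CommutativeMonoidSum +-0-commutativeMonoid
  using (sum-syntax) renaming (sum to ∑; sum-cong-≗ to ∑-cong; sum-remove to ∑-remove; sum-permute to ∑-permute)

ind : Bool → ℕ
ind b = if b then 1 else 0

ind≤1 : ∀ b → ind b ≤ 1
ind≤1 true = ≤-refl
ind≤1 false = z≤n

ind-mono : ∀ {a c} → (a ≡ true → c ≡ true) → ind a ≤ ind c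
ind-mono {true} a⇒c rewrite a⇒c refl = ≤-refl
ind-mono {false} _ = z≤n

∑-const : ∀ n c → ∑[ i < n ] c ≡ n * c
∑-const zero c = refl
∑-const (suc n) c = cong (c +_) (∑-const n c)

∑-ind-mono : ∀ n (p q : Fin n → Bool) → (∀ i → p i ≡ true → q i ≡ true) →
  ∑[ i < n ] ind (p i) ≤ ∑[ i < n ] ind (q i)
∑-ind-mono zero p q p⇒q = z≤n
∑-ind-mono (suc n) p q p⇒q = +-mono-≤ (ind-mono (p⇒q zero)) (∑-ind-mono n (p ∘ suc) (q ∘ suc) (p⇒q ∘ suc))

∑-ind-< : ∀ n (p q : Fin n → Bool) i → (∀ j → p j ≡ true → q j ≡ true) →
  p i ≡ false → q i ≡ true → ∑[ j < n ] ind (p j) < ∑[ j < n ] ind (q j)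
∑-ind-< (suc n) p q i p⇒q pi≡false qi≡true = begin-strict
  ∑[ j < suc n ] ind (p j)                     ≡⟨ ∑-remove {i = i} (ind ∘ p) ⟩
  ind (p i) + ∑[ j < n ] ind (p (punchIn i j)) ≡⟨ cong (λ b → ind b + ∑[ j < n ] ind (p (punchIn i j))) pi≡false ⟩
  ∑[ j < n ] ind (p (punchIn i j))             <⟨ s≤s (∑-ind-mono n _ _ (p⇒q ∘ punchIn i)) ⟩
  1 + ∑[ j < n ] ind (q (punchIn i j))         ≡⟨ cong (λ b → ind b + ∑[ j < n ] ind (q (punchIn i j))) qi≡true ⟨
  ind (q i) + ∑[ j < n ] ind (q (punchIn i j)) ≡⟨ ∑-remove {i = i} (ind ∘ q) ⟨
  ∑[ j < suc n ] ind (q j)                     ∎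
  where open ≤-Reasoning

∑-ind-<n : ∀ n (p : Fin n → Bool) i → p i ≡ false → ∑[ j < n ] ind (p j) < n
∑-ind-<n n p i pi≡false = begin-strict
  ∑[ j < n ] ind (p j) <⟨ ∑-ind-< n p (λ _ → true) i (λ _ _ → refl) pi≡false refl ⟩
  ∑[ j < n ] 1         ≡⟨ ∑-const n 1 ⟩
  n * 1                ≡⟨ *-identityʳ n ⟩
  n                    ∎
  where open ≤-Reasoning

∑-ind-≥1 : ∀ n (p : Fin n → Bool) i → p i ≡ true → 1 ≤ ∑[ j < n ] ind (p j)
∑-ind-≥1 (suc n) p zero pi rewrite pi = s≤s z≤n
∑-ind-≥1 (suc n) p (suc i) pi = ≤-trans (∑-ind-≥1 n (p ∘ suc) i pi) (m≤n+m _ (ind (p zero)))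

∑-ind-≥2 : ∀ n (p : Fin n → Bool) i j → ¬ i ≡ j → p i ≡ true → p j ≡ true → 2 ≤ ∑[ k < n ] ind (p k)
∑-ind-≥2 (suc n) p zero zero i≢j _ _ = contradiction refl i≢j
∑-ind-≥2 (suc n) p zero (suc j) _ pi pj rewrite pi = s≤s (∑-ind-≥1 n (p ∘ suc) j pj)
∑-ind-≥2 (suc n) p (suc i) zero _ pi pj rewrite pj = s≤s (∑-ind-≥1 n (p ∘ suc) i pi)
∑-ind-≥2 (suc n) p (suc i) (suc j) i≢j pi pj =
  ≤-trans (∑-ind-≥2 n (p ∘ suc) i j (i≢j ∘ cong suc) pi pj) (m≤n+m _ (ind (p zero)))

∑-ind-witness : ∀ n (p : Fin n → Bool) → 1 ≤ ∑[ i < n ] ind (p i) → Σ (Fin n) λ i → p i ≡ true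
∑-ind-witness (suc n) p 1≤∑ with p zero in p0
... | true = zero , p0
... | false = let i , pi = ∑-ind-witness n (p ∘ suc) 1≤∑ in suc i , pi

∑-ind-two-witnesses : ∀ n (p : Fin n → Bool) → 2 ≤ ∑[ i < n ] ind (p i) →
  Σ (Fin n) λ i → Σ (Fin n) λ j → ¬ i ≡ j × p i ≡ true × p j ≡ true
∑-ind-two-witnesses (suc n) p 2≤∑ with p zero in p0
... | true = let j , pj = ∑-ind-witness n (p ∘ suc) (s≤s⁻¹ 2≤∑) in zero , suc j , (λ ()) , p0 , pj
... | false = let i , j , i≢j , pi , pj = ∑-ind-two-witnesses n (p ∘ suc) 2≤∑
              in suc i , suc j , i≢j ∘ Finₚ.suc-injective , pi , pj

∑-permute′ : ∀ {n} (σ : Permutation′ n) (g : Fin n → ℕ) → ∑[ i < n ] g (σ ⟨$⟩ʳ i) ≡ ∑[ i < n ] g i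
∑-permute′ σ g = sym (∑-permute g σ)

argmax : ∀ {n} (h : Fin n → ℕ) → Fin n → Σ (Fin n) λ m → ∀ u → h u ≤ h m
argmax {suc zero} h _ = zero , λ { zero → ≤-refl }
argmax {suc (suc n)} h _ with argmax (h ∘ suc) zero
... | m , max with h zero ≤? h (suc m)
...   | yes h0≤ = suc m , λ { zero → h0≤ ; (suc u) → max u }
...   | no h0≰ = zero , λ { zero → ≤-refl ; (suc u) → ≤-trans (max u) (<⇒≤ (≰⇒> h0≰)) }

boolCount-++ : {A : Set} (p : A → Bool) (xs ys : List A) →
  boolCount p (xs ++ ys) ≡ boolCount p xs + boolCount p ys
boolCount-++ p [] ys = refl
boolCount-++ p (x ∷ xs) ys = trans (cong (ind (p x) +_) (boolCount-++ p xs ys)) (sym (+-assoc (ind (p x)) _ _))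

boolCount-map : {A B : Set} (p : B → Bool) (f : A → B) (xs : List A) →
  boolCount p (map f xs) ≡ boolCount (p ∘ f) xs
boolCount-map p f [] = refl
boolCount-map p f (x ∷ xs) = cong (ind (p (f x)) +_) (boolCount-map p f xs)

boolCount-concatMap : {A B : Set} (p : B → Bool) (f : A → List B) (xs : List A) →
  boolCount p (concatMap f xs) ≡ sum (map (λ x → boolCount p (f x)) xs)
boolCount-concatMap p f [] = refl
boolCount-concatMap p f (x ∷ xs) =
  trans (boolCount-++ p (f x) (concatMap f xs)) (cong (boolCount p (f x) +_) (boolCount-concatMap p f xs))

boolCount-cong : {A : Set} {p q : A → Bool} → (∀ x → p x ≡ q x) → (xs : List A) →
  boolCount p xs ≡ boolCount q xs
boolCount-cong p≗q [] = refl
boolCount-cong p≗q (x ∷ xs) = cong₂ _+_ (cong ind (p≗q x)) (boolCount-cong p≗q xs)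

boolCount-false : {A : Set} (p : A → Bool) → (∀ x → p x ≡ false) → (xs : List A) → boolCount p xs ≡ 0
boolCount-false p p≡false [] = refl
boolCount-false p p≡false (x ∷ xs) rewrite p≡false x = boolCount-false p p≡false xs

boolCount-split : {A : Set} (p q : A → Bool) (xs : List A) →
  boolCount p xs ≡ boolCount (λ x → p x ∧ q x) xs + boolCount (λ x → p x ∧ not (q x)) xs
boolCount-split p q [] = refl
boolCount-split p q (x ∷ xs) rewrite boolCount-split p q xs with p x | q x
... | false | _ = refl
... | true | true = refl
... | true | false = sym (+-suc _ _)

boolCount-tabulate : {A : Set} (p : A → Bool) {n : ℕ} (f : Fin n → A) →
  boolCount p (tabulate f) ≡ ∑[ i < n ] ind (p (f i))
boolCount-tabulate p {zero} f = refl
boolCount-tabulate p {suc n} f = cong (ind (p (f zero)) +_) (boolCount-tabulate p (f ∘ suc))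

boolCount-allFin : ∀ n (p : Fin n → Bool) → boolCount p (allFin n) ≡ ∑[ i < n ] ind (p i)
boolCount-allFin n p = boolCount-tabulate p (λ i → i)

sum-map-tabulate : ∀ {A : Set} (g : A → ℕ) {n} (f : Fin n → A) → sum (map g (tabulate f)) ≡ ∑[ i < n ] g (f i)
sum-map-tabulate g {zero} f = refl
sum-map-tabulate g {suc n} f = cong (g (f zero) +_) (sum-map-tabulate g (f ∘ suc))

sum-map-allFin : ∀ n (g : Fin n → ℕ) → sum (map g (allFin n)) ≡ ∑[ i < n ] g i
sum-map-allFin n g = sum-map-tabulate g (λ i → i)

sum-map-++ : {A : Set} (g : A → ℕ) (xs ys : List A) → sum (map g (xs ++ ys)) ≡ sum (map g xs) + sum (map g ys)
sum-map-++ g xs ys = trans (cong sum (map-++ g xs ys)) (sum-++ (map g xs) (map g ys))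

sum-map-cong : {A : Set} {g h : A → ℕ} → (∀ x → g x ≡ h x) → (xs : List A) → sum (map g xs) ≡ sum (map h xs)
sum-map-cong g≗h xs = cong sum (map-cong g≗h xs)

sum-map-∘ : {A B : Set} (g : B → ℕ) (f : A → B) (xs : List A) → sum (map g (map f xs)) ≡ sum (map (g ∘ f) xs)
sum-map-∘ g f xs = cong sum (sym (map-∘ xs))

sum-map-*ˡ : {A : Set} (c : ℕ) (g : A → ℕ) (xs : List A) → sum (map (λ x → c * g x) xs) ≡ c * sum (map g xs)
sum-map-*ˡ c g [] = sym (*-zeroʳ c)
sum-map-*ˡ c g (x ∷ xs) = trans (cong (c * g x +_) (sum-map-*ˡ c g xs)) (sym (*-distribˡ-+ c (g x) _))

sum-map-*ʳ : {A : Set} (c : ℕ) (g : A → ℕ) (xs : List A) → sum (map (λ x → g x * c) xs) ≡ sum (map g xs) * c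
sum-map-*ʳ c g [] = refl
sum-map-*ʳ c g (x ∷ xs) = trans (cong (g x * c +_) (sum-map-*ʳ c g xs)) (sym (*-distribʳ-+ c (g x) _))

sum-map-zero : {A : Set} {g : A → ℕ} → (∀ x → g x ≡ 0) → (xs : List A) → sum (map g xs) ≡ 0
sum-map-zero g≡0 [] = refl
sum-map-zero g≡0 (x ∷ xs) rewrite g≡0 x = sum-map-zero g≡0 xs

∧-true : ∀ {a c} → a ∧ c ≡ true → a ≡ true × c ≡ true
∧-true {true} {true} _ = refl , refl

≡ᵇ-refl : ∀ m → (m ≡ᵇ m) ≡ true
≡ᵇ-refl m = Equivalence.to T-≡ (≡⇒≡ᵇ m m refl)

≡ᵇ-true⁻ : ∀ {m n} → (m ≡ᵇ n) ≡ true → m ≡ n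
≡ᵇ-true⁻ {m} {n} e = ≡ᵇ⇒≡ m n (Equivalence.from T-≡ e)

≡ᵇ-false : ∀ {m n} → ¬ m ≡ n → (m ≡ᵇ n) ≡ false
≡ᵇ-false {m} {n} m≢n with m ≡ᵇ n in e
... | true = contradiction (≡ᵇ-true⁻ e) m≢n
... | false = refl

<ᵇ-true : ∀ {m n} → m < n → (m <ᵇ n) ≡ true
<ᵇ-true m<n = Equivalence.to T-≡ (<⇒<ᵇ m<n)

<ᵇ-true⁻ : ∀ {m n} → (m <ᵇ n) ≡ true → m < n
<ᵇ-true⁻ {m} {n} e = <ᵇ⇒< m n (Equivalence.from T-≡ e)

<ᵇ-false : ∀ {m n} → n ≤ m → (m <ᵇ n) ≡ false
<ᵇ-false {m} {n} n≤m with m <ᵇ n in e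
... | true = contradiction n≤m (<⇒≱ (<ᵇ-true⁻ e))
... | false = refl

≤ᵇ-true : ∀ {m n} → m ≤ n → (m ≤ᵇ n) ≡ true
≤ᵇ-true m≤n = Equivalence.to T-≡ (≤⇒≤ᵇ m≤n)

≤ᵇ-true⁻ : ∀ {m n} → (m ≤ᵇ n) ≡ true → m ≤ n
≤ᵇ-true⁻ {m} {n} e = ≤ᵇ⇒≤ m n (Equivalence.from T-≡ e)

_==_ : ∀ {n} → Fin n → Fin n → Bool
x == y = toℕ x ≡ᵇ toℕ y

==-refl : ∀ {n} (x : Fin n) → (x == x) ≡ true
==-refl x = ≡ᵇ-refl (toℕ x)

==-true⁻ : ∀ {n} {x y : Fin n} → (x == y) ≡ true → x ≡ y
==-true⁻ e = toℕ-injective (≡ᵇ-true⁻ e)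

==-false : ∀ {n} {x y : Fin n} → ¬ x ≡ y → (x == y) ≡ false
==-false x≢y = ≡ᵇ-false (x≢y ∘ toℕ-injective)

==-punchIn : ∀ {n} (i : Fin (suc n)) (x y : Fin n) → (punchIn i x == punchIn i y) ≡ (x == y)
==-punchIn i x y with x ≟ y
... | yes refl = trans (==-refl (punchIn i x)) (sym (==-refl x))
... | no x≢y = trans (==-false (x≢y ∘ punchIn-injective i x y)) (sym (==-false x≢y))

==-punchInˡ : ∀ {n} (i : Fin (suc n)) (y : Fin n) → (punchIn i y == i) ≡ false
==-punchInˡ i y = ==-false (punchInᵢ≢i i y)

==-punchInʳ : ∀ {n} (i : Fin (suc n)) (y : Fin n) → (i == punchIn i y) ≡ false
==-punchInʳ i y = ==-false (punchInᵢ≢i i y ∘ sym)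

-- Surjections and Stirling numbers
every : (n : ℕ) → (Fin n → Bool) → Bool
every zero g = true
every (suc n) g = g zero ∧ every n (g ∘ suc)

allB-tabulate : {A : Set} (p : A → Bool) {n : ℕ} (f : Fin n → A) → allB p (tabulate f) ≡ every n (p ∘ f)
allB-tabulate p {zero} f = refl
allB-tabulate p {suc n} f = cong (p (f zero) ∧_) (allB-tabulate p (f ∘ suc))

allB-allFin : ∀ n (g : Fin n → Bool) → allB g (allFin n) ≡ every n g
allB-allFin n g = allB-tabulate g (λ i → i)

every-cong : ∀ n {g h : Fin n → Bool} → (∀ i → g i ≡ h i) → every n g ≡ every n h
every-cong zero g≗h = refl
every-cong (suc n) g≗h = cong₂ _∧_ (g≗h zero) (every-cong n (g≗h ∘ suc))

every-punchIn : ∀ n (i : Fin (suc n)) (g : Fin (suc n) → Bool) → every (suc n) g ≡ g i ∧ every n (g ∘ punchIn i)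
every-punchIn n zero g = refl
every-punchIn (suc n) (suc i) g rewrite every-punchIn n i (g ∘ suc) = ∧-swap (g zero) (g (suc i)) _
  where
  ∧-swap : ∀ a b c → a ∧ (b ∧ c) ≡ b ∧ (a ∧ c)
  ∧-swap a b c = trans (sym (∧-assoc a b c)) (trans (cong (_∧ c) (∧-comm a b)) (∧-assoc b a c))

every-true⁻ : ∀ n (g : Fin n → Bool) → every n g ≡ true → ∀ i → g i ≡ true
every-true⁻ (suc n) g all zero = proj₁ (∧-true all)
every-true⁻ (suc n) g all (suc i) = every-true⁻ n (g ∘ suc) (proj₂ (∧-true all)) i

every-true : ∀ n (g : Fin n → Bool) → (∀ i → g i ≡ true) → every n g ≡ true
every-true zero g all = refl
every-true (suc n) g all rewrite all zero = every-true n (g ∘ suc) (all ∘ suc)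

hits : ∀ {m j} → Fin j → Vec (Fin j) m → Bool
hits i f = 1 ≤ᵇ occ i f

isSurjective : ∀ {m j} → Vec (Fin j) m → Bool
isSurjective {j = j} f = allB (λ b → hits b f) (allFin j)

hits-∷ : ∀ {m j} (i b : Fin j) (f : Vec (Fin j) m) → hits b (i V.∷ f) ≡ (i == b) ∨ hits b f
hits-∷ i b f with i == b
... | true = refl
... | false = refl

occ-punchIn : ∀ {m n} (i : Fin (suc n)) (y : Fin n) (f : Vec (Fin n) m) →
  occ (punchIn i y) (V.map (punchIn i) f) ≡ occ y f
occ-punchIn i y V.[] = refl
occ-punchIn i y (x V.∷ f) = cong₂ _+_ (cong ind (==-punchIn i x y)) (occ-punchIn i y f)

isSurjective-∷-hits : ∀ {m j} (i : Fin j) (f : Vec (Fin j) m) →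
  isSurjective (i V.∷ f) ∧ hits i f ≡ isSurjective f
isSurjective-∷-hits {j = j} i f with hits i f in hit
... | true = begin
  isSurjective (i V.∷ f) ∧ true             ≡⟨ ∧-identityʳ _ ⟩
  allB (λ b → hits b (i V.∷ f)) (allFin j)  ≡⟨ allB-allFin j _ ⟩
  every j (λ b → hits b (i V.∷ f))          ≡⟨ every-cong j hits-∷-hit ⟩
  every j (λ b → hits b f)                  ≡⟨ allB-allFin j _ ⟨
  isSurjective f                            ∎
  where
  open ≡-Reasoning
  hits-∷-hit : ∀ b → hits b (i V.∷ f) ≡ hits b f
  hits-∷-hit b with i ≟ b
  ... | yes refl = trans (hits-∷ i i f) (trans (cong (_∨ hits i f) (==-refl i)) (sym hit))
  ... | no i≢b = trans (hits-∷ i b f) (cong (_∨ hits b f) (==-false i≢b))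
... | false = trans (∧-zeroʳ _) (sym miss)
  where
  miss : isSurjective f ≡ false
  miss with isSurjective f in surj
  ... | false = refl
  ... | true = contradiction (trans (sym hit) (every-true⁻ j _ (trans (sym (allB-allFin j _)) surj) i)) λ ()

isSurjective-∷-punchIn : ∀ {m j} (i : Fin (suc j)) (f : Vec (Fin j) m) →
  isSurjective (i V.∷ V.map (punchIn i) f) ≡ isSurjective f
isSurjective-∷-punchIn {j = j} i f = begin
  isSurjective (i V.∷ f′)                         ≡⟨ allB-allFin (suc j) _ ⟩
  every (suc j) (λ b → hits b (i V.∷ f′))         ≡⟨ every-punchIn j i (λ b → hits b (i V.∷ f′)) ⟩
  hits i (i V.∷ f′) ∧ every j (λ y → hits (punchIn i y) (i V.∷ f′))
    ≡⟨ cong₂ _∧_ (trans (hits-∷ i i f′) (cong (_∨ hits i f′) (==-refl i))) (every-cong j hits-punchIn) ⟩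
  every j (λ y → hits y f)                        ≡⟨ allB-allFin j _ ⟨
  isSurjective f                                  ∎
  where
  open ≡-Reasoning
  f′ = V.map (punchIn i) f
  hits-punchIn : ∀ y → hits (punchIn i y) (i V.∷ f′) ≡ hits y f
  hits-punchIn y rewrite ==-punchInʳ i y = cong (1 ≤ᵇ_) (occ-punchIn i y f)

boolCount-allFuns-suc : ∀ m ℓ (p : Vec (Fin ℓ) (suc m) → Bool) →
  boolCount p (allFuns (suc m) ℓ) ≡ ∑[ x < ℓ ] boolCount (p ∘ (x V.∷_)) (allFuns m ℓ)
boolCount-allFuns-suc m ℓ p = begin
  boolCount p (allFuns (suc m) ℓ)
    ≡⟨ boolCount-concatMap p (λ x → map (x V.∷_) (allFuns m ℓ)) (allFin ℓ) ⟩
  sum (map (λ x → boolCount p (map (x V.∷_) (allFuns m ℓ))) (allFin ℓ))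
    ≡⟨ sum-map-allFin ℓ _ ⟩
  ∑[ x < ℓ ] boolCount p (map (x V.∷_) (allFuns m ℓ))
    ≡⟨ ∑-cong (λ x → boolCount-map p (x V.∷_) (allFuns m ℓ)) ⟩
  ∑[ x < ℓ ] boolCount (p ∘ (x V.∷_)) (allFuns m ℓ) ∎
  where open ≡-Reasoning

-- Functions [m] → [j+1] missing the value i correspond, via punchIn i, to all functions [m] → [j].
boolCount-missing : ∀ m {j} (i : Fin (suc j)) (p : Vec (Fin (suc j)) m → Bool) →
  boolCount (λ f → p f ∧ not (hits i f)) (allFuns m (suc j)) ≡ boolCount (p ∘ V.map (punchIn i)) (allFuns m j)
boolCount-missing zero i p = cong (λ b → ind b + 0) (∧-identityʳ (p V.[]))
boolCount-missing (suc m) {j} i p = begin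
  boolCount P (allFuns (suc m) (suc j))          ≡⟨ boolCount-allFuns-suc m (suc j) P ⟩
  ∑[ x < suc j ] G x                             ≡⟨ ∑-remove {i = i} G ⟩
  G i + ∑[ y < j ] G (punchIn i y)               ≡⟨ cong₂ _+_ Gᵢ≡0 (∑-cong G-punchIn) ⟩
  ∑[ y < j ] boolCount (p ∘ V.map (punchIn i) ∘ (y V.∷_)) (allFuns m j)
                                                 ≡⟨ boolCount-allFuns-suc m j (p ∘ V.map (punchIn i)) ⟨
  boolCount (p ∘ V.map (punchIn i)) (allFuns (suc m) j) ∎
  where
  open ≡-Reasoning
  P : Vec (Fin (suc j)) (suc m) → Bool
  P f = p f ∧ not (hits i f)
  G : Fin (suc j) → ℕ
  G x = boolCount (P ∘ (x V.∷_)) (allFuns m (suc j))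
  Gᵢ≡0 : G i ≡ 0
  Gᵢ≡0 = boolCount-false _ (λ f → trans (cong (λ b → p (i V.∷ f) ∧ not (1 ≤ᵇ (ind b + occ i f))) (==-refl i))
                                        (∧-zeroʳ (p (i V.∷ f))))
                           (allFuns m (suc j))
  G-punchIn : ∀ y → G (punchIn i y) ≡ boolCount (p ∘ V.map (punchIn i) ∘ (y V.∷_)) (allFuns m j)
  G-punchIn y = trans (boolCount-cong (λ f → cong (λ b → p (punchIn i y V.∷ f) ∧ not (1 ≤ᵇ (ind b + occ i f)))
                                                  (==-punchInˡ i y))
                                      (allFuns m (suc j)))
                      (boolCount-missing m i (p ∘ (punchIn i y V.∷_)))

#surjections : ℕ → ℕ → ℕ
#surjections m j = boolCount isSurjective (allFuns m j)

#surjections-∷ : ∀ m {j} (i : Fin (suc j)) →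
  boolCount (isSurjective ∘ (i V.∷_)) (allFuns m (suc j)) ≡ #surjections m (suc j) + #surjections m j
#surjections-∷ m {j} i = trans (boolCount-split _ (hits i) (allFuns m (suc j)))
  (cong₂ _+_ (boolCount-cong (isSurjective-∷-hits i) (allFuns m (suc j)))
             (trans (boolCount-missing m i (isSurjective ∘ (i V.∷_)))
                    (boolCount-cong (isSurjective-∷-punchIn i) (allFuns m j))))

#surjections≡ : ∀ m j → #surjections m j ≡ j ! * S m j
#surjections≡ zero zero = refl
#surjections≡ zero (suc j) = sym (*-zeroʳ (suc j !))
#surjections≡ (suc m) zero = refl
#surjections≡ (suc m) (suc j) = begin
  #surjections (suc m) (suc j)
    ≡⟨ boolCount-allFuns-suc m (suc j) isSurjective ⟩
  ∑[ i < suc j ] boolCount (isSurjective ∘ (i V.∷_)) (allFuns m (suc j))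
    ≡⟨ ∑-cong (#surjections-∷ m) ⟩
  ∑[ i < suc j ] (#surjections m (suc j) + #surjections m j)
    ≡⟨ ∑-const (suc j) _ ⟩
  suc j * (#surjections m (suc j) + #surjections m j)
    ≡⟨ cong (λ x → suc j * x) (cong₂ _+_ (#surjections≡ m (suc j)) (#surjections≡ m j)) ⟩
  suc j * ((suc j * j !) * S m (suc j) + j ! * S m j)
    ≡⟨ stirling-step (suc j) (j !) (S m (suc j)) (S m j) ⟩
  (suc j * j !) * (suc j * S m (suc j) + S m j) ∎
  where
  open ≡-Reasoning
  open +-*-Solver
  stirling-step : ∀ J F X Y → J * ((J * F) * X + F * Y) ≡ (J * F) * (J * X + Y)
  stirling-step = solve 4 (λ J F X Y → J :* ((J :* F) :* X :+ F :* Y) := (J :* F) :* (J :* X :+ Y)) refl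

-- Words over a disjoint union of alphabets
vectors : {A : Set} → List A → (n : ℕ) → List (Vec A n)
vectors xs zero = V.[] ∷ []
vectors xs (suc n) = concatMap (λ x → map (x V.∷_) (vectors xs n)) xs

#words : {A : Set} → (List A → Bool) → List A → ℕ → ℕ
#words P xs m = boolCount (P ∘ toList) (vectors xs m)

#words-suc : {A : Set} (P : List A → Bool) (xs : List A) (m : ℕ) →
  #words P xs (suc m) ≡ sum (map (λ x → #words (P ∘ (x ∷_)) xs m) xs)
#words-suc P xs m = trans (boolCount-concatMap (P ∘ toList) (λ x → map (x V.∷_) (vectors xs m)) xs)
                          (sum-map-cong (λ x → boolCount-map (P ∘ toList) (x V.∷_) (vectors xs m)) xs)

lefts : {A B : Set} → List (A ⊎ B) → List A
lefts [] = []
lefts (inj₁ a ∷ w) = a ∷ lefts w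
lefts (inj₂ b ∷ w) = lefts w

rights : {A B : Set} → List (A ⊎ B) → List B
rights [] = []
rights (inj₁ a ∷ w) = rights w
rights (inj₂ b ∷ w) = b ∷ rights w

_⊕_ : {A B : Set} → List A → List B → List (A ⊎ B)
xs ⊕ ys = map inj₁ xs ++ map inj₂ ys

splitsAs : {A B : Set} → ℕ → (List A → Bool) → (List B → Bool) → List (A ⊎ B) → Bool
splitsAs m P Q w = (length (lefts w) ≡ᵇ m) ∧ P (lefts w) ∧ Q (rights w)

#words-⊕-suc : {A B : Set} (xs : List A) (ys : List B) (n : ℕ) (R : List (A ⊎ B) → Bool) →
  #words R (xs ⊕ ys) (suc n) ≡ sum (map (λ x → #words (R ∘ (inj₁ x ∷_)) (xs ⊕ ys) n) xs)
                               + sum (map (λ y → #words (R ∘ (inj₂ y ∷_)) (xs ⊕ ys) n) ys)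
#words-⊕-suc xs ys n R = begin
  #words R (xs ⊕ ys) (suc n)                             ≡⟨ #words-suc R (xs ⊕ ys) n ⟩
  sum (map G (map inj₁ xs ++ map inj₂ ys))               ≡⟨ sum-map-++ G (map inj₁ xs) (map inj₂ ys) ⟩
  sum (map G (map inj₁ xs)) + sum (map G (map inj₂ ys))  ≡⟨ cong₂ _+_ (sum-map-∘ G inj₁ xs) (sum-map-∘ G inj₂ ys) ⟩
  sum (map (G ∘ inj₁) xs) + sum (map (G ∘ inj₂) ys)      ∎
  where
  open ≡-Reasoning
  G : _ → ℕ
  G z = #words (R ∘ (z ∷_)) (xs ⊕ ys) n

module _ {A B : Set} (xs : List A) (ys : List B) (n : ℕ)
         (#words-⊕ₙ : ∀ m P Q → #words (splitsAs m P Q) (xs ⊕ ys) n ≡ (n C m) * #words P xs m * #words Q ys (n ∸ m))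
         where

  #words-⊕-inj₁ : ∀ m P Q → sum (map (λ x → #words (splitsAs (suc m) P Q ∘ (inj₁ x ∷_)) (xs ⊕ ys) n) xs)
                            ≡ (n C m) * #words P xs (suc m) * #words Q ys (n ∸ m)
  #words-⊕-inj₁ m P Q = begin
    sum (map (λ x → #words (splitsAs m (P ∘ (x ∷_)) Q) (xs ⊕ ys) n) xs)
      ≡⟨ sum-map-cong (λ x → #words-⊕ₙ m (P ∘ (x ∷_)) Q) xs ⟩
    sum (map (λ x → (n C m) * #words (P ∘ (x ∷_)) xs m * Y) xs)
      ≡⟨ sum-map-*ʳ Y (λ x → (n C m) * #words (P ∘ (x ∷_)) xs m) xs ⟩
    sum (map (λ x → (n C m) * #words (P ∘ (x ∷_)) xs m) xs) * Y
      ≡⟨ cong (_* Y) (sum-map-*ˡ (n C m) _ xs) ⟩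
    (n C m) * sum (map (λ x → #words (P ∘ (x ∷_)) xs m) xs) * Y
      ≡⟨ cong (λ c → (n C m) * c * Y) (#words-suc P xs m) ⟨
    (n C m) * #words P xs (suc m) * Y ∎
    where
    open ≡-Reasoning
    Y = #words Q ys (n ∸ m)

  #words-⊕-inj₂ : ∀ m P Q → sum (map (λ y → #words (splitsAs m P Q ∘ (inj₂ y ∷_)) (xs ⊕ ys) n) ys)
                            ≡ (n C m) * #words P xs m * #words Q ys (suc (n ∸ m))
  #words-⊕-inj₂ m P Q = begin
    sum (map (λ y → #words (splitsAs m P (Q ∘ (y ∷_))) (xs ⊕ ys) n) ys)
      ≡⟨ sum-map-cong (λ y → #words-⊕ₙ m P (Q ∘ (y ∷_))) ys ⟩
    sum (map (λ y → (n C m) * #words P xs m * #words (Q ∘ (y ∷_)) ys (n ∸ m)) ys)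
      ≡⟨ sum-map-*ˡ ((n C m) * #words P xs m) _ ys ⟩
    (n C m) * #words P xs m * sum (map (λ y → #words (Q ∘ (y ∷_)) ys (n ∸ m)) ys)
      ≡⟨ cong ((n C m) * #words P xs m *_) (#words-suc Q ys (n ∸ m)) ⟨
    (n C m) * #words P xs m * #words Q ys (suc (n ∸ m)) ∎
    where open ≡-Reasoning

  #words-⊕-step : ∀ m P Q → #words (splitsAs m P Q) (xs ⊕ ys) (suc n)
                            ≡ (suc n C m) * #words P xs m * #words Q ys (suc n ∸ m)
  #words-⊕-step zero P Q = trans (#words-⊕-suc xs ys n (splitsAs 0 P Q))
    (cong₂ _+_ (sum-map-zero (λ x → boolCount-false _ (λ _ → refl) (vectors (xs ⊕ ys) n)) xs) (#words-⊕-inj₂ zero P Q))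
  #words-⊕-step (suc m) P Q = begin
    #words (splitsAs (suc m) P Q) (xs ⊕ ys) (suc n)
      ≡⟨ #words-⊕-suc xs ys n (splitsAs (suc m) P Q) ⟩
    sum (map (λ x → #words (splitsAs (suc m) P Q ∘ (inj₁ x ∷_)) (xs ⊕ ys) n) xs)
      + sum (map (λ y → #words (splitsAs (suc m) P Q ∘ (inj₂ y ∷_)) (xs ⊕ ys) n) ys)
      ≡⟨ cong₂ _+_ (#words-⊕-inj₁ m P Q) (trans (#words-⊕-inj₂ (suc m) P Q) remaining) ⟩
    (n C m) * X * Y + (n C suc m) * X * Y
      ≡⟨ pascal (n C m) (n C suc m) X Y ⟩
    ((n C m) + (n C suc m)) * X * Y
      ≡⟨ cong (λ c → c * X * Y) (nCk+nC[k+1]≡[n+1]C[k+1] n m) ⟩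
    (suc n C suc m) * X * Y ∎
    where
    open ≡-Reasoning
    open +-*-Solver
    X = #words P xs (suc m)
    Y = #words Q ys (n ∸ m)
    pascal : ∀ a b x y → a * x * y + b * x * y ≡ (a + b) * x * y
    pascal = solve 4 (λ a b x y → a :* x :* y :+ b :* x :* y := (a :+ b) :* x :* y) refl
    remaining : (n C suc m) * X * #words Q ys (suc (n ∸ suc m)) ≡ (n C suc m) * X * Y
    remaining with suc m ≤? n
    ... | yes m<n = cong (λ l → (n C suc m) * X * #words Q ys l) (sym (+-∸-assoc 1 m<n))
    ... | no m≮n rewrite k>n⇒nCk≡0 {n} {suc m} (≰⇒> m≮n) = refl

-- The factor n C m chooses the positions of the m letters taken from xs.
#words-⊕ : {A B : Set} (xs : List A) (ys : List B) (n m : ℕ) (P : List A → Bool) (Q : List B → Bool) →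
  #words (splitsAs m P Q) (xs ⊕ ys) n ≡ (n C m) * #words P xs m * #words Q ys (n ∸ m)
#words-⊕ xs ys zero zero P Q with P [] | Q []
... | true | true = refl
... | true | false = refl
... | false | _ = refl
#words-⊕ xs ys zero (suc m) P Q = refl
#words-⊕ xs ys (suc n) m P Q = #words-⊕-step xs ys n (#words-⊕ xs ys n) m P Q

-- Level structures
levelType : Bool → ℕ → Bool
levelType b zero = b
levelType b (suc j) = not (levelType b j)

levelAdj : ∀ {n} → Bool → (Fin n → ℕ) → Fin n → Fin n → Bool
levelAdj b h u v = if u == v then false else levelType b (h u ⊔ h v)

levelGraph : ∀ {n} → Bool → (Fin n → ℕ) → Graph n
levelGraph b h = V.tabulate λ u → V.tabulate λ v → levelAdj b h u v

levelGraph-cong : ∀ {n} b {h h′ : Fin n → ℕ} → (∀ v → h v ≡ h′ v) → levelGraph b h ≡ levelGraph b h′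
levelGraph-cong b h≗h′ = tabulate-cong λ u → tabulate-cong λ v →
  cong₂ (λ x y → if u == v then false else levelType b (x ⊔ y)) (h≗h′ u) (h≗h′ v)

record Canonical {n : ℕ} (h : Fin n → ℕ) : Set where
  field
    gapless : ∀ v j → j < h v → Σ (Fin n) λ w → h w ≡ j
    root₁ root₂ : Fin n
    root₁≢root₂ : ¬ root₁ ≡ root₂
    root₁-level : h root₁ ≡ 0
    root₂-level : h root₂ ≡ 0

levelAdj-≢ : ∀ {n} b (h : Fin n → ℕ) {u v} → ¬ u ≡ v → levelAdj b h u v ≡ levelType b (h u ⊔ h v)
levelAdj-≢ b h u≢v rewrite ==-false u≢v = refl

levelAdj-below : ∀ {n} b (h : Fin n → ℕ) {u v} → ¬ u ≡ v → h v ≤ h u → levelAdj b h u v ≡ levelType b (h u)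
levelAdj-below b h u≢v hv≤hu = trans (levelAdj-≢ b h u≢v) (cong (levelType b) (m≥n⇒m⊔n≡m hv≤hu))

levelAdj-above : ∀ {n} b (h : Fin n → ℕ) {u v} → ¬ u ≡ v → h u ≤ h v → levelAdj b h u v ≡ levelType b (h v)
levelAdj-above b h u≢v hu≤hv = trans (levelAdj-≢ b h u≢v) (cong (levelType b) (m≤n⇒m⊔n≡n hu≤hv))

not≢ : ∀ c → ¬ not c ≡ c
not≢ c e = not-¬ refl (sym e)

module _ {n : ℕ} (b : Bool) (h : Fin n → ℕ) (canon : Canonical h) where
  open Canonical canon

  lowerVertex : ∀ u → Σ (Fin n) λ w → ¬ w ≡ u × h w ≤ h u
  lowerVertex u with h u in hu
  ... | zero with root₁ ≟ u
  ...   | no r₁≢u = root₁ , r₁≢u , ≤-reflexive root₁-level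
  ...   | yes refl = root₂ , root₁≢root₂ ∘ sym , ≤-reflexive root₂-level
  lowerVertex u | suc j with gapless u j (≤-reflexive (sym hu))
  ... | w , hw =
    w , (λ w≡u → 1+n≢n (trans (sym hu) (trans (sym (cong h w≡u)) hw))) , ≤-trans (≤-reflexive hw) (n≤1+n j)

  -- w lies one level above u if the levels of u and v have the same type, and at or below u's level
  -- otherwise.
  separatingVertex : ∀ u v → h u < h v → Σ (Fin n) λ w → ¬ w ≡ u × ¬ w ≡ v ×
    levelAdj b h v w ≡ levelType b (h v) × levelAdj b h u w ≡ not (levelType b (h v))
  separatingVertex u v hu<hv with levelType b (h u) Data.Bool.≟ levelType b (h v)
  ... | yes same = w , w≢u , w≢v , levelAdj-below b h (w≢v ∘ sym) (≤-trans (≤-reflexive hw) (<⇒≤ hu+1<hv))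
                 , trans (levelAdj-above b h (w≢u ∘ sym) (≤-trans (n≤1+n (h u)) (≤-reflexive (sym hw))))
                         (trans (cong (levelType b) hw) (cong not same))
    where
    hu+1<hv : suc (h u) < h v
    hu+1<hv with m≤n⇒m<n∨m≡n hu<hv
    ... | inj₁ p = p
    ... | inj₂ e = contradiction (trans (cong (levelType b) e) (sym same)) (not≢ (levelType b (h u)))
    w = proj₁ (gapless v (suc (h u)) hu+1<hv)
    hw : h w ≡ suc (h u)
    hw = proj₂ (gapless v (suc (h u)) hu+1<hv)
    w≢u : ¬ w ≡ u
    w≢u w≡u = 1+n≢n (trans (sym hw) (cong h w≡u))
    w≢v : ¬ w ≡ v
    w≢v w≡v = <-irrefl (trans (sym hw) (cong h w≡v)) hu+1<hv
  ... | no differ = w , w≢u , w≢v , levelAdj-below b h (w≢v ∘ sym) (≤-trans hw≤hu (<⇒≤ hu<hv))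
                  , trans (levelAdj-below b h (w≢u ∘ sym) hw≤hu) (≢⇒≡not differ)
    where
    w = proj₁ (lowerVertex u)
    w≢u = proj₁ (proj₂ (lowerVertex u))
    hw≤hu = proj₂ (proj₂ (lowerVertex u))
    w≢v : ¬ w ≡ v
    w≢v w≡v = <-irrefl (cong h w≡v) (≤-<-trans hw≤hu hu<hv)
    ≢⇒≡not : ∀ {x y} → ¬ x ≡ y → x ≡ not y
    ≢⇒≡not {true} {true} x≢y = contradiction refl x≢y
    ≢⇒≡not {true} {false} _ = refl
    ≢⇒≡not {false} {true} _ = refl
    ≢⇒≡not {false} {false} x≢y = contradiction refl x≢y

levelAdj-higher : ∀ {n} b (h : Fin n → ℕ) {u v w} → h u < h v → ¬ w ≡ u → ¬ w ≡ v →
  levelAdj b h v w ≡ levelType b (h v) ⊎ levelAdj b h v w ≡ levelAdj b h u w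
levelAdj-higher b h {u} {v} {w} hu<hv w≢u w≢v with h w ≤? h v
... | yes hw≤hv = inj₁ (levelAdj-below b h (w≢v ∘ sym) hw≤hv)
... | no hw≰hv = inj₂ (trans (levelAdj-above b h (w≢v ∘ sym) hv≤hw)
                             (sym (levelAdj-above b h (w≢u ∘ sym) (≤-trans (<⇒≤ hu<hv) hv≤hw))))
  where hv≤hw = <⇒≤ (≰⇒> hw≰hv)

levelAdj-sameLevel : ∀ {n} b (h : Fin n → ℕ) {u v w} → h u ≡ h v → ¬ w ≡ u → ¬ w ≡ v →
  levelAdj b h u w ≡ levelAdj b h v w
levelAdj-sameLevel b h {u} {v} {w} hu≡hv w≢u w≢v =
  trans (levelAdj-≢ b h (w≢u ∘ sym))
        (trans (cong (λ l → levelType b (l ⊔ h w)) hu≡hv) (sym (levelAdj-≢ b h (w≢v ∘ sym))))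

module _ {n : ℕ} {b b′ : Bool} {h h′ : Fin n → ℕ} (canon : Canonical h)
         (same : ∀ u v → levelAdj b h u v ≡ levelAdj b′ h′ u v) where

  -- A vertex separating u and v for h also separates them for h′, which rules out h′ v ≤ h′ u.
  sameAdjacency-preserves-< : ∀ {u v} → h u < h v → h′ u < h′ v
  sameAdjacency-preserves-< {u} {v} hu<hv with separatingVertex b h canon u v hu<hv
  ... | w , w≢u , w≢v , adj-vw , adj-uw with <-cmp (h′ u) (h′ v)
  ...   | tri< p _ _ = p
  ...   | tri≈ _ e _ = contradiction (trans (sym adj-uw) (trans (same u w)
            (trans (levelAdj-sameLevel b′ h′ e w≢u w≢v) (trans (sym (same v w)) adj-vw)))) (not≢ _)
  ...   | tri> _ _ p with levelAdj-higher b′ h′ p w≢v w≢u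
  ...     | inj₂ e = contradiction (trans (sym adj-uw) (trans (same u w) (trans e (trans (sym (same v w)) adj-vw)))) (not≢ _)
  ...     | inj₁ e = contradiction (trans (sym adj-uw) (trans (same u w) (trans e
              (trans (sym (levelAdj-above b′ h′ (u≢v ∘ sym) (<⇒≤ p))) (trans (sym (same v u))
                (levelAdj-below b h (u≢v ∘ sym) (<⇒≤ hu<hv))))))) (not≢ _)
    where
    u≢v : ¬ u ≡ v
    u≢v refl = <-irrefl refl hu<hv

  sameAdjacency-levels-≤ : ∀ v → h v ≤ h′ v
  sameAdjacency-levels-≤ v = go (h v) v refl
    where
    open Canonical canon
    go : ∀ j v → h v ≡ j → j ≤ h′ v
    go zero v _ = z≤n
    go (suc j) v hv with gapless v j (≤-reflexive (sym hv))
    ... | w , hw = ≤-<-trans (go j w hw) (sameAdjacency-preserves-< (≤-reflexive (trans (cong suc hw) (sym hv))))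

levelGraph-injective : ∀ {n} {b b′ : Bool} {h h′ : Fin n → ℕ} → Canonical h → Canonical h′ →
  levelGraph b h ≡ levelGraph b′ h′ → b ≡ b′ × (∀ v → h v ≡ h′ v)
levelGraph-injective {b = b} {b′} {h} {h′} canon canon′ eq = b≡b′ , h≗h′
  where
  same : ∀ u v → levelAdj b h u v ≡ levelAdj b′ h′ u v
  same u v = begin
    levelAdj b h u v                  ≡⟨ entry b h ⟨
    lookup (lookup (levelGraph b h) u) v ≡⟨ cong (λ G → lookup (lookup G u) v) eq ⟩
    lookup (lookup (levelGraph b′ h′) u) v ≡⟨ entry b′ h′ ⟩
    levelAdj b′ h′ u v                ∎
    where
    open ≡-Reasoning
    entry : ∀ c g → lookup (lookup (levelGraph c g) u) v ≡ levelAdj c g u v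
    entry c g = trans (cong (λ r → lookup r v) (lookup∘tabulate _ u)) (lookup∘tabulate _ v)
  h≗h′ : ∀ v → h v ≡ h′ v
  h≗h′ v = ≤-antisym (sameAdjacency-levels-≤ {b = b} {b′} {h} {h′} canon same v)
                     (sameAdjacency-levels-≤ {b = b′} {b} {h′} {h} canon′ (λ u w → sym (same u w)) v)
  open Canonical canon
  b≡b′ : b ≡ b′
  b≡b′ = begin
    b                                    ≡⟨ cong (levelType b) (cong₂ _⊔_ root₁-level root₂-level) ⟨
    levelType b (h root₁ ⊔ h root₂)      ≡⟨ levelAdj-≢ b h root₁≢root₂ ⟨
    levelAdj b h root₁ root₂             ≡⟨ same root₁ root₂ ⟩
    levelAdj b′ h′ root₁ root₂           ≡⟨ levelAdj-≢ b′ h′ root₁≢root₂ ⟩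
    levelType b′ (h′ root₁ ⊔ h′ root₂)   ≡⟨ cong (levelType b′) (cong₂ _⊔_ (trans (sym (h≗h′ root₁)) root₁-level)
                                                                       (trans (sym (h≗h′ root₂)) root₂-level)) ⟩
    b′                                   ∎
    where open ≡-Reasoning

-- Construction sequences versus level structures
injective⇒surjective : ∀ {n} (f : Fin n → Fin n) → (∀ {x y} → f x ≡ f y → x ≡ y) →
  ∀ y → Σ (Fin n) λ x → f x ≡ y
injective⇒surjective {suc n} f f-inj y with any? (λ x → f x ≟ y)
... | yes hit = hit
... | no miss = contradiction (injective⇒≤ {f = f′} f′-inj) (<-irrefl refl)
  where
  f′ : Fin (suc n) → Fin n
  f′ x = punchOut {i = y} {j = f x} (λ y≡fx → miss (x , sym y≡fx))
  f′-inj : ∀ {x z} → f′ x ≡ f′ z → x ≡ z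
  f′-inj {x} {z} = f-inj ∘ punchOut-injective (λ y≡fx → miss (x , sym y≡fx)) (λ y≡fz → miss (z , sym y≡fz))

dominatingCount : ∀ {n} → Bool → (Fin n → ℕ) → ℕ
dominatingCount {n} b h = ∑[ v < n ] ind (levelType b (h v))

domCount-suc : ∀ {n} (t : Fin (suc n) → Bool) → domCount t ≡ ∑[ p < n ] ind (t (suc p))
domCount-suc {n} t = begin
  domCount t                                             ≡⟨ boolCount-allFin (suc n) _ ⟩
  ind (t zero ∧ false) + ∑[ p < n ] ind (t (suc p) ∧ true) ≡⟨ cong₂ (λ x y → ind x + y) (∧-zeroʳ (t zero))
                                                                  (∑-cong (cong ind ∘ ∧-identityʳ ∘ t ∘ suc)) ⟩
  ∑[ p < n ] ind (t (suc p))                             ∎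
  where open ≡-Reasoning

-- The initial vertex, at position 0, has type b but is not counted by domCount; the Fin n argument
-- excludes n = 0.
domCount-relabel : ∀ {n} (t : Fin n → Bool) (σ : Permutation′ n) (g : Fin n → Bool) (b : Bool) →
  (∀ p → ¬ toℕ p ≡ 0 → t p ≡ g (σ ⟨$⟩ʳ p)) → (∀ p → toℕ p ≡ 0 → g (σ ⟨$⟩ʳ p) ≡ b) → Fin n →
  domCount t + ind b ≡ ∑[ v < n ] ind (g v)
domCount-relabel {suc n} t σ g b t≡g g₀≡b _ = begin
  domCount t + ind b                                    ≡⟨ cong₂ _+_ (domCount-suc t) (cong ind (sym (g₀≡b zero refl))) ⟩
  ∑[ p < n ] ind (t (suc p)) + ind (g (σ ⟨$⟩ʳ zero))    ≡⟨ +-comm _ (ind (g (σ ⟨$⟩ʳ zero))) ⟩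
  ind (g (σ ⟨$⟩ʳ zero)) + ∑[ p < n ] ind (t (suc p))    ≡⟨ cong (ind (g (σ ⟨$⟩ʳ zero)) +_)
                                                             (∑-cong (λ p → cong ind (t≡g (suc p) λ ()))) ⟩
  ∑[ p < suc n ] ind (g (σ ⟨$⟩ʳ p))                     ≡⟨ ∑-permute′ σ (ind ∘ g) ⟩
  ∑[ v < suc n ] ind (g v)                              ∎
  where open ≡-Reasoning

adjPos-diag : ∀ {n} (t : Fin n → Bool) (p : Fin n) → adjPos t p p ≡ false
adjPos-diag t p rewrite <ᵇ-false (≤-refl {toℕ p}) = refl

levelAdj-diag : ∀ {n} b (h : Fin n → ℕ) (u : Fin n) → levelAdj b h u u ≡ false
levelAdj-diag b h u rewrite ==-refl u = refl

-- Sorting the vertices by level, ties broken by label, yields a construction sequence of levelGraph b h.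
module FromLevels {n : ℕ} (b : Bool) (h : Fin n → ℕ) (canon : Canonical h) where
  open Canonical canon

  key : Fin n → ℕ
  key v = toℕ v + h v * n

  key-< : ∀ {u v} → h u < h v → key u < key v
  key-< {u} {v} hu<hv = begin-strict
    toℕ u + h u * n  <⟨ +-monoˡ-< (h u * n) (toℕ<n u) ⟩
    suc (h u) * n    ≤⟨ *-monoˡ-≤ n hu<hv ⟩
    h v * n          ≤⟨ m≤n+m (h v * n) (toℕ v) ⟩
    toℕ v + h v * n  ∎
    where open ≤-Reasoning

  key-injective : ∀ {u v} → key u ≡ key v → u ≡ v
  key-injective {u} {v} e with <-cmp (h u) (h v)
  ... | tri< p _ _ = contradiction e (<⇒≢ (key-< p))
  ... | tri> _ _ p = contradiction (sym e) (<⇒≢ (key-< p))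
  ... | tri≈ _ q _ =
    toℕ-injective (+-cancelʳ-≡ (h u * n) (toℕ u) (toℕ v) (trans e (cong (λ l → toℕ v + l * n) (sym q))))

  key-<⇒≤ : ∀ {u v} → key u < key v → h u ≤ h v
  key-<⇒≤ {u} {v} lt with h u ≤? h v
  ... | yes p = p
  ... | no p = contradiction (key-< (≰⇒> p)) (<-asym lt)

  rank : Fin n → ℕ
  rank v = ∑[ u < n ] ind (key u <ᵇ key v)

  rank-< : ∀ {u v} → key u < key v → rank u < rank v
  rank-< {u} {v} lt = ∑-ind-< n (λ w → key w <ᵇ key u) (λ w → key w <ᵇ key v) u
    (λ w e → <ᵇ-true (<-trans (<ᵇ-true⁻ e) lt)) (<ᵇ-false (≤-refl {key u})) (<ᵇ-true lt)

  rank-injective : ∀ {u v} → rank u ≡ rank v → u ≡ v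
  rank-injective {u} {v} e with <-cmp (key u) (key v)
  ... | tri< p _ _ = contradiction e (<⇒≢ (rank-< p))
  ... | tri≈ _ q _ = key-injective q
  ... | tri> _ _ p = contradiction (sym e) (<⇒≢ (rank-< p))

  rank-<⁻ : ∀ {u v} → rank u < rank v → key u < key v
  rank-<⁻ {u} {v} lt with <-cmp (key u) (key v)
  ... | tri< p _ _ = p
  ... | tri≈ _ q _ = contradiction (cong rank (key-injective q)) (<⇒≢ lt)
  ... | tri> _ _ p = contradiction lt (<-asym (rank-< p))

  position : Fin n → Fin n
  position v = fromℕ< (∑-ind-<n n (λ u → key u <ᵇ key v) v (<ᵇ-false (≤-refl {key v})))

  toℕ-position : ∀ v → toℕ (position v) ≡ rank v
  toℕ-position v = toℕ-fromℕ< _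

  position-injective : ∀ {u v} → position u ≡ position v → u ≡ v
  position-injective {u} {v} e = rank-injective (trans (sym (toℕ-position u)) (trans (cong toℕ e) (toℕ-position v)))

  vertexAt : Fin n → Fin n
  vertexAt p = proj₁ (injective⇒surjective position position-injective p)

  position-vertexAt : ∀ p → position (vertexAt p) ≡ p
  position-vertexAt p = proj₂ (injective⇒surjective position position-injective p)

  vertexAt-position : ∀ v → vertexAt (position v) ≡ v
  vertexAt-position v = position-injective (position-vertexAt (position v))

  σ : Permutation′ n
  σ = permutation vertexAt position vertexAt-position position-vertexAt

  t : Fin n → Bool
  t p = levelType b (h (vertexAt p))

  adjPos-position : ∀ u v → adjPos t (position u) (position v) ≡ levelAdj b h u v
  adjPos-position u v with <-cmp (rank u) (rank v)
  ... | tri< p _ _ rewrite toℕ-position u | toℕ-position v | <ᵇ-true p =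
    trans (cong (levelType b ∘ h) (vertexAt-position v))
          (sym (levelAdj-above b h (λ { refl → <-irrefl refl p }) (key-<⇒≤ (rank-<⁻ p))))
  ... | tri> _ _ p rewrite toℕ-position u | toℕ-position v | <ᵇ-false (<⇒≤ p) | <ᵇ-true p =
    trans (cong (levelType b ∘ h) (vertexAt-position u))
          (sym (levelAdj-below b h (λ { refl → <-irrefl refl p }) (key-<⇒≤ (rank-<⁻ p))))
  ... | tri≈ _ q _ with rank-injective {u} {v} q
  ...   | refl = trans (adjPos-diag t (position u)) (sym (levelAdj-diag b h u))

  buildGraph≡levelGraph : buildGraph σ t ≡ levelGraph b h
  buildGraph≡levelGraph = tabulate-cong (λ u → tabulate-cong (λ v → adjPos-position u v))

  level-vertexAt₀ : ∀ p → toℕ p ≡ 0 → h (vertexAt p) ≡ 0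
  level-vertexAt₀ p p≡0 with h (vertexAt p) in hv
  ... | zero = refl
  ... | suc _ = contradiction rank≡0 (m<n⇒n≢0 (rank-< (key-< (subst₂ _<_ (sym root₁-level) (sym hv) z<s))))
    where
    rank≡0 : rank (vertexAt p) ≡ 0
    rank≡0 = trans (sym (toℕ-position (vertexAt p))) (trans (cong toℕ (position-vertexAt p)) p≡0)

  domCount≡ : domCount t + ind b ≡ dominatingCount b h
  domCount≡ = domCount-relabel t σ (levelType b ∘ h) b (λ _ _ → refl)
    (λ p p≡0 → cong (levelType b) (level-vertexAt₀ p p≡0)) root₁

atℕ : ∀ {n} → (Fin n → Bool) → ℕ → Bool
atℕ {zero} t q = false
atℕ {suc n} t zero = t zero
atℕ {suc n} t (suc q) = atℕ (t ∘ suc) q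

atℕ-toℕ : ∀ {n} (t : Fin n → Bool) (p : Fin n) → atℕ t (toℕ p) ≡ t p
atℕ-toℕ t zero = refl
atℕ-toℕ t (suc p) = atℕ-toℕ (t ∘ suc) p

levelType-xor : ∀ b l x y → levelType b l ≡ y → levelType b (l + ind (x xor y)) ≡ x
levelType-xor b l true true e = trans (cong (levelType b) (+-identityʳ l)) e
levelType-xor b l false false e = trans (cong (levelType b) (+-identityʳ l)) e
levelType-xor b l true false e = trans (cong (levelType b) (+-comm l 1)) (cong not e)
levelType-xor b l false true e = trans (cong (levelType b) (+-comm l 1)) (cong not e)

-- The level of a position counts the type changes along the construction sequence up to it;
-- positions 0 and 1 form level 0.
module ToLevels {n : ℕ} (σ : Permutation′ n) (t : Fin n → Bool) (2≤n : 2 ≤ n) where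

  level : ℕ → ℕ
  level zero = 0
  level (suc zero) = 0
  level (suc (suc q)) = level (suc q) + ind (atℕ t (suc (suc q)) xor atℕ t (suc q))

  b : Bool
  b = atℕ t 1

  levelType-level : ∀ q → levelType b (level (suc q)) ≡ atℕ t (suc q)
  levelType-level zero = refl
  levelType-level (suc q) = levelType-xor b (level (suc q)) _ _ (levelType-level q)

  level-step : ∀ q → level q ≤ level (suc q)
  level-step zero = z≤n
  level-step (suc q) = m≤m+n (level (suc q)) _

  level-suc≤ : ∀ q → level (suc q) ≤ suc (level q)
  level-suc≤ zero = z≤n
  level-suc≤ (suc q) = ≤-trans (+-monoʳ-≤ (level (suc q)) (ind≤1 _)) (≤-reflexive (+-comm (level (suc q)) 1))

  level-mono : ∀ {q q′} → q ≤ q′ → level q ≤ level q′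
  level-mono {q} {zero} z≤n = ≤-refl
  level-mono {q} {suc q′} q≤q′ with m≤n⇒m<n∨m≡n q≤q′
  ... | inj₁ q<q′ = ≤-trans (level-mono (s≤s⁻¹ q<q′)) (level-step q′)
  ... | inj₂ refl = ≤-refl

  level≤ : ∀ q → level q ≤ q
  level≤ zero = z≤n
  level≤ (suc q) = ≤-trans (level-suc≤ q) (s≤s (level≤ q))

  level-gapless : ∀ q j → j < level q → Σ ℕ λ q′ → q′ < q × level q′ ≡ j
  level-gapless (suc (suc q)) j j<l with j <? level (suc q) | level-gapless (suc q) j
  ... | yes j<l′ | below = let q′ , q′<q , e = below j<l′ in q′ , m<n⇒m<1+n q′<q , e
  ... | no j≮l′ | _ =
    suc q , n<1+n (suc q) , ≤-antisym (≮⇒≥ j≮l′) (s≤s⁻¹ (≤-trans j<l (level-suc≤ (suc q))))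

  position : Fin n → Fin n
  position v = σ ⟨$⟩ˡ v

  h : Fin n → ℕ
  h v = level (toℕ (position v))

  h<n : ∀ v → h v < n
  h<n v = ≤-<-trans (level≤ (toℕ (position v))) (toℕ<n (position v))

  vertexAt : ∀ q → q < n → Fin n
  vertexAt q q<n = σ ⟨$⟩ʳ fromℕ< q<n

  h-vertexAt : ∀ q (q<n : q < n) → h (vertexAt q q<n) ≡ level q
  h-vertexAt q q<n = cong level (trans (cong toℕ (inverseˡ σ)) (toℕ-fromℕ< q<n))

  0<n : 0 < n
  0<n = <-trans z<s 2≤n

  canon : Canonical h
  canon = record
    { gapless = λ v j j<hv → let q , q<p , e = level-gapless (toℕ (position v)) j j<hv
                                 q<n = <-trans q<p (toℕ<n (position v))
                             in vertexAt q q<n , trans (h-vertexAt q q<n) e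
    ; root₁ = vertexAt 0 0<n
    ; root₂ = vertexAt 1 2≤n
    ; root₁≢root₂ = λ e → 0≢1+n (trans (sym (toℕ-fromℕ< 0<n))
                                 (trans (cong toℕ (trans (sym (inverseˡ σ)) (trans (cong (σ ⟨$⟩ˡ_) e) (inverseˡ σ))))
                                        (toℕ-fromℕ< 2≤n)))
    ; root₁-level = h-vertexAt 0 0<n
    ; root₂-level = h-vertexAt 1 2≤n
    }

  levelType-position : ∀ (p : Fin n) → ¬ toℕ p ≡ 0 → levelType b (level (toℕ p)) ≡ t p
  levelType-position p p≢0 with toℕ p in tp
  ... | zero = contradiction refl p≢0
  ... | suc q = trans (levelType-level q) (trans (cong (atℕ t) (sym tp)) (atℕ-toℕ t p))

  adjPos≡levelAdj : ∀ u v → adjPos t (position u) (position v) ≡ levelAdj b h u v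
  adjPos≡levelAdj u v with <-cmp (toℕ (position u)) (toℕ (position v))
  ... | tri< lt _ _ rewrite <ᵇ-true lt =
    sym (trans (levelAdj-above b h (λ { refl → <-irrefl refl lt }) (level-mono (<⇒≤ lt)))
               (levelType-position (position v) (m<n⇒n≢0 lt)))
  ... | tri> _ _ gt rewrite <ᵇ-false (<⇒≤ gt) | <ᵇ-true gt =
    sym (trans (levelAdj-below b h (λ { refl → <-irrefl refl gt }) (level-mono (<⇒≤ gt)))
               (levelType-position (position u) (m<n⇒n≢0 gt)))
  ... | tri≈ _ q _ with trans (sym (inverseʳ σ)) (trans (cong (σ ⟨$⟩ʳ_) (toℕ-injective q)) (inverseʳ σ))
  ...   | refl = trans (adjPos-diag t (position u)) (sym (levelAdj-diag b h u))

  buildGraph≡levelGraph : buildGraph σ t ≡ levelGraph b h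
  buildGraph≡levelGraph = tabulate-cong (λ u → tabulate-cong (λ v → adjPos≡levelAdj u v))

  domCount≡ : domCount t + ind b ≡ dominatingCount b h
  domCount≡ = domCount-relabel t σ (levelType b ∘ h) b
    (λ p p≢0 → sym (trans (cong (levelType b ∘ level ∘ toℕ) (inverseˡ σ)) (levelType-position p p≢0)))
    (λ p p≡0 → cong (levelType b) (trans (cong (level ∘ toℕ) (inverseˡ σ)) (cong level p≡0)))
    (vertexAt 0 0<n)

dbl : ℕ → ℕ
dbl zero = zero
dbl (suc a) = suc (suc (dbl a))

fromParity : ℕ ⊎ ℕ → ℕ
fromParity (inj₁ q) = dbl q
fromParity (inj₂ q) = suc (dbl q)

parity : ℕ → ℕ ⊎ ℕ
parity zero = inj₁ zero
parity (suc j) = next (parity j)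
  where
  next : ℕ ⊎ ℕ → ℕ ⊎ ℕ
  next (inj₁ q) = inj₂ q
  next (inj₂ q) = inj₁ (suc q)

fromParity-parity : ∀ j → fromParity (parity j) ≡ j
fromParity-parity zero = refl
fromParity-parity (suc j) with parity j | fromParity-parity j
... | inj₁ q | refl = refl
... | inj₂ q | refl = refl

parity-dbl : ∀ q → parity (dbl q) ≡ inj₁ q
parity-dbl zero = refl
parity-dbl (suc q) rewrite parity-dbl q = refl

parity-fromParity : ∀ x → parity (fromParity x) ≡ x
parity-fromParity (inj₁ q) = parity-dbl q
parity-fromParity (inj₂ q) rewrite parity-dbl q = refl

levelType-dbl : ∀ b q → levelType b (dbl q) ≡ b
levelType-dbl b zero = refl
levelType-dbl b (suc q) rewrite levelType-dbl b q = not-involutive b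

-- inj₁ a is the a-th dominating level and inj₂ c the c-th isolated level; which parity they
-- have depends on the type b of level 0.
levelOf : Bool → ℕ ⊎ ℕ → ℕ
levelOf true x = fromParity x
levelOf false x = fromParity (swap x)

sideOf : Bool → ℕ → ℕ ⊎ ℕ
sideOf true j = parity j
sideOf false j = swap (parity j)

levelOf-sideOf : ∀ b j → levelOf b (sideOf b j) ≡ j
levelOf-sideOf true j = fromParity-parity j
levelOf-sideOf false j rewrite swap-involutive (parity j) = fromParity-parity j

levelOf-injective : ∀ b {x y} → levelOf b x ≡ levelOf b y → x ≡ y
levelOf-injective true {x} {y} e = trans (sym (parity-fromParity x)) (trans (cong parity e) (parity-fromParity y))
levelOf-injective false {x} {y} e =
  trans (sym (swap-involutive x)) (trans (cong swap (levelOf-injective true e)) (swap-involutive y))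

isLeft : {A B : Set} → A ⊎ B → Bool
isLeft (inj₁ _) = true
isLeft (inj₂ _) = false

levelType-levelOf : ∀ b x → levelType b (levelOf b x) ≡ isLeft x
levelType-levelOf true (inj₁ a) = levelType-dbl true a
levelType-levelOf true (inj₂ a) = cong not (levelType-dbl true a)
levelType-levelOf false (inj₁ a) = cong not (levelType-dbl false a)
levelType-levelOf false (inj₂ a) = levelType-dbl false a

dbl-mono-≤ : ∀ {a c} → a ≤ c → dbl a ≤ dbl c
dbl-mono-≤ {zero} _ = z≤n
dbl-mono-≤ (s≤s a≤c) = s≤s (s≤s (dbl-mono-≤ a≤c))

dbl-≤-< : ∀ {a c} → a < suc c → dbl a < suc (dbl c)
dbl-≤-< (s≤s a≤c) = s≤s (dbl-mono-≤ a≤c)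

odd-<-dbl : ∀ {a c} → a < c → suc (dbl a) < dbl c
odd-<-dbl (s≤s a≤c) = s≤s (s≤s (dbl-mono-≤ a≤c))

dbl-< : ∀ {a c} → a < c → dbl a < dbl c
dbl-< a<c = <-trans (n<1+n _) (odd-<-dbl a<c)

odd-< : ∀ {a c} → a < c → suc (dbl a) < suc (dbl c)
odd-< a<c = s≤s (dbl-< a<c)

dbl-<⁻ : ∀ {a c} → dbl a < dbl c → a < c
dbl-<⁻ {a} {c} lt with a <? c
... | yes a<c = a<c
... | no a≮c = contradiction (dbl-mono-≤ (≮⇒≥ a≮c)) (<⇒≱ lt)

dbl-≤-<⁻ : ∀ {a c} → dbl a < suc (dbl c) → a < suc c
dbl-≤-<⁻ {a} {c} lt with a <? suc c
... | yes a<c = a<c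
... | no a≮c = contradiction (≤-trans (n≤1+n _) (dbl-mono-≤ (≮⇒≥ a≮c))) (<⇒≱ lt)

odd-<-dbl⁻ : ∀ {a c} → suc (dbl a) < dbl c → a < c
odd-<-dbl⁻ lt = dbl-<⁻ (<-trans (n<1+n _) lt)

odd-<⁻ : ∀ {a c} → suc (dbl a) < suc (dbl c) → a < c
odd-<⁻ lt = dbl-<⁻ (s≤s⁻¹ lt)

dbl-injective : ∀ {a c} → dbl a ≡ dbl c → a ≡ c
dbl-injective {zero} {zero} _ = refl
dbl-injective {suc a} {suc c} e = cong suc (dbl-injective (suc-injective (suc-injective e)))

dbl≢suc-dbl : ∀ a c → ¬ dbl a ≡ suc (dbl c)
dbl≢suc-dbl (suc a) zero e = 0≢1+n (sym (suc-injective e))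
dbl≢suc-dbl (suc a) (suc c) e = dbl≢suc-dbl a c (suc-injective (suc-injective e))

a≤dbl-a : ∀ a → a ≤ dbl a
a≤dbl-a zero = z≤n
a≤dbl-a (suc a) = s≤s (≤-trans (a≤dbl-a a) (n≤1+n _))

-- In a shape (b , i , v), level 0 has type b, there are suc i dominating levels, and the top level
-- is isolated iff v.
Shape : Set
Shape = Bool × ℕ × Bool

isolatedLevels : Shape → ℕ
isolatedLevels (true , i , false) = i
isolatedLevels (true , i , true) = suc i
isolatedLevels (false , i , v) = suc (if v then suc i else i)

levelCount : Shape → ℕ
levelCount (true , i , false) = suc (dbl i)
levelCount (true , i , true) = dbl (suc i)
levelCount (false , i , true) = suc (dbl (suc i))
levelCount (false , i , false) = dbl (suc i)

Block : Shape → Set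
Block (b , i , v) = Fin (suc i) ⊎ Fin (isolatedLevels (b , i , v))

blockIndex : ∀ {a c} → Fin a ⊎ Fin c → ℕ ⊎ ℕ
blockIndex = Sum.map toℕ toℕ

blockLevel : ∀ sh → Block sh → ℕ
blockLevel (b , i , v) x = levelOf b (blockIndex x)

blockIndex-injective : ∀ {a c} {x y : Fin a ⊎ Fin c} → blockIndex x ≡ blockIndex y → x ≡ y
blockIndex-injective {x = inj₁ a} {inj₁ a′} e = cong inj₁ (toℕ-injective (inj₁-injective e))
blockIndex-injective {x = inj₂ c} {inj₂ c′} e = cong inj₂ (toℕ-injective (inj₂-injective e))
blockIndex-injective {x = inj₁ _} {inj₂ _} ()
blockIndex-injective {x = inj₂ _} {inj₁ _} ()

blockLevel-injective : ∀ sh {x y : Block sh} → blockLevel sh x ≡ blockLevel sh y → x ≡ y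
blockLevel-injective (b , i , v) e = blockIndex-injective (levelOf-injective b e)

blockLevel-< : ∀ sh (x : Block sh) → blockLevel sh x < levelCount sh
blockLevel-< (true , i , false) (inj₁ a) = dbl-≤-< (toℕ<n a)
blockLevel-< (true , i , false) (inj₂ c) = odd-< (toℕ<n c)
blockLevel-< (true , i , true) (inj₁ a) = dbl-< (toℕ<n a)
blockLevel-< (true , i , true) (inj₂ c) = odd-<-dbl (toℕ<n c)
blockLevel-< (false , i , true) (inj₁ a) = odd-< (toℕ<n a)
blockLevel-< (false , i , true) (inj₂ c) = dbl-≤-< (toℕ<n c)
blockLevel-< (false , i , false) (inj₁ a) = odd-<-dbl (toℕ<n a)
blockLevel-< (false , i , false) (inj₂ c) = dbl-< (toℕ<n c)

blockAtIndex : ∀ sh (y : ℕ ⊎ ℕ) → levelOf (proj₁ sh) y < levelCount sh → Σ (Block sh) λ x → blockIndex x ≡ y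
blockAtIndex (true , i , false) (inj₁ a) lt = inj₁ (fromℕ< (dbl-≤-<⁻ lt)) , cong inj₁ (toℕ-fromℕ< _)
blockAtIndex (true , i , false) (inj₂ c) lt = inj₂ (fromℕ< (odd-<⁻ lt)) , cong inj₂ (toℕ-fromℕ< _)
blockAtIndex (true , i , true) (inj₁ a) lt = inj₁ (fromℕ< (dbl-<⁻ lt)) , cong inj₁ (toℕ-fromℕ< _)
blockAtIndex (true , i , true) (inj₂ c) lt = inj₂ (fromℕ< (odd-<-dbl⁻ lt)) , cong inj₂ (toℕ-fromℕ< _)
blockAtIndex (false , i , true) (inj₁ a) lt = inj₁ (fromℕ< (odd-<⁻ lt)) , cong inj₁ (toℕ-fromℕ< _)
blockAtIndex (false , i , true) (inj₂ c) lt = inj₂ (fromℕ< (dbl-≤-<⁻ lt)) , cong inj₂ (toℕ-fromℕ< _)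
blockAtIndex (false , i , false) (inj₁ a) lt = inj₁ (fromℕ< (odd-<-dbl⁻ lt)) , cong inj₁ (toℕ-fromℕ< _)
blockAtIndex (false , i , false) (inj₂ c) lt = inj₂ (fromℕ< (dbl-<⁻ lt)) , cong inj₂ (toℕ-fromℕ< _)

blockAtLevel : ∀ sh j → j < levelCount sh → Σ (Block sh) λ x → blockLevel sh x ≡ j
blockAtLevel sh@(b , i , v) j j<L with blockAtIndex sh (sideOf b j) (subst (_< levelCount sh) (sym (levelOf-sideOf b j)) j<L)
... | x , e = x , trans (cong (levelOf b) e) (levelOf-sideOf b j)

levelType-blockLevel : ∀ sh (x : Block sh) → levelType (proj₁ sh) (blockLevel sh x) ≡ isLeft x
levelType-blockLevel (b , i , v) (inj₁ a) = levelType-levelOf b (inj₁ (toℕ a))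
levelType-blockLevel (b , i , v) (inj₂ c) = levelType-levelOf b (inj₂ (toℕ c))

firstBlock : ∀ sh → Block sh
firstBlock (true , i , v) = inj₁ zero
firstBlock (false , i , v) = inj₂ zero

blockLevel-firstBlock : ∀ sh → blockLevel sh (firstBlock sh) ≡ 0
blockLevel-firstBlock (true , i , v) = refl
blockLevel-firstBlock (false , i , v) = refl

levelCount-injective : ∀ b i v i′ v′ → levelCount (b , i , v) ≡ levelCount (b , i′ , v′) → i ≡ i′ × v ≡ v′
levelCount-injective true i false i′ false e = dbl-injective (suc-injective e) , refl
levelCount-injective true i true i′ true e = suc-injective (dbl-injective e) , refl
levelCount-injective false i true i′ true e = suc-injective (dbl-injective (suc-injective e)) , refl
levelCount-injective false i false i′ false e = suc-injective (dbl-injective e) , refl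
levelCount-injective true i false i′ true e = contradiction (sym e) (dbl≢suc-dbl (suc i′) i)
levelCount-injective true i true i′ false e = contradiction e (dbl≢suc-dbl (suc i) i′)
levelCount-injective false i true i′ false e = contradiction (sym e) (dbl≢suc-dbl (suc i′) (suc i))
levelCount-injective false i false i′ true e = contradiction e (dbl≢suc-dbl (suc i) (suc i′))

dominatingLevels<levelCount : ∀ sh → proj₁ (proj₂ sh) < levelCount sh
dominatingLevels<levelCount (true , i , false) = s≤s (a≤dbl-a i)
dominatingLevels<levelCount (true , i , true) = ≤-trans (s≤s (a≤dbl-a i)) (n≤1+n _)
dominatingLevels<levelCount (false , i , true) = ≤-trans (s≤s (a≤dbl-a i)) (≤-trans (n≤1+n _) (n≤1+n _))
dominatingLevels<levelCount (false , i , false) = ≤-trans (s≤s (a≤dbl-a i)) (n≤1+n _)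

-- When b = false there is at least one dominating level, so at least two levels.
shapeWithLevelCount : ∀ b M → (b ≡ false → 1 ≤ M) → Σ ℕ λ i → Σ Bool λ v → levelCount (b , i , v) ≡ suc M
shapeWithLevelCount true M _ with parity M | fromParity-parity M
... | inj₁ q | e = q , false , cong suc e
... | inj₂ q | e = q , true , cong suc e
shapeWithLevelCount false zero 1≤0 = contradiction (1≤0 refl) λ ()
shapeWithLevelCount false (suc M) _ with parity M | fromParity-parity M
... | inj₁ q | e = q , false , cong (λ l → suc (suc l)) e
... | inj₂ q | e = q , true , cong (λ l → suc (suc l)) e

allFuns≡vectors : ∀ m ℓ → allFuns m ℓ ≡ vectors (allFin ℓ) m
allFuns≡vectors zero ℓ = refl
allFuns≡vectors (suc m) ℓ rewrite allFuns≡vectors m ℓ = refl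

∈-vectors : {A : Set} (xs : List A) {n : ℕ} (w : Vec A n) → (∀ v → lookup w v ∈ xs) → w ∈ vectors xs n
∈-vectors xs V.[] _ = here refl
∈-vectors xs (x V.∷ w) w⊆xs =
  ∈-concatMap⁺ _ (lose (w⊆xs zero) (∈-map⁺ (x V.∷_) (∈-vectors xs w (w⊆xs ∘ suc))))

Unique-concatMap : {A B : Set} (F : A → List B) (xs : List A) → Unique xs → (∀ x → Unique (F x)) →
  (∀ x y {z} → z ∈ F x → z ∈ F y → x ≡ y) → Unique (concatMap F xs)
Unique-concatMap F [] _ _ _ = []
Unique-concatMap F (x ∷ xs) (x∉xs ∷ unique) uniqueF disjoint =
  ++⁺ (uniqueF x) (Unique-concatMap F xs unique uniqueF disjoint) λ (z∈Fx , z∈rest) →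
    let y , y∈xs , z∈Fy = find (∈-concatMap⁻ F {xs = xs} z∈rest) in All.lookup x∉xs y∈xs (disjoint x y z∈Fx z∈Fy)

Unique-vectors : {A : Set} (xs : List A) (n : ℕ) → Unique xs → Unique (vectors xs n)
Unique-vectors xs zero _ = [] ∷ []
Unique-vectors xs (suc n) unique =
  Unique-concatMap _ xs unique (λ x → map⁺ ∷-injectiveʳ (Unique-vectors xs n unique)) heads-agree
  where
  heads-agree : ∀ x y {z} → z ∈ map (x V.∷_) (vectors xs n) → z ∈ map (y V.∷_) (vectors xs n) → x ≡ y
  heads-agree x y z∈x z∈y with ∈-map⁻ (x V.∷_) z∈x | ∈-map⁻ (y V.∷_) z∈y
  ... | _ , _ , refl | _ , _ , e = ∷-injectiveˡ e

pairs : {A : Set} {B : A → Set} → List A → ((a : A) → List (B a)) → List (Σ A B)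
pairs xs F = concatMap (λ a → map (a ,_) (F a)) xs

Unique-pairs : {A : Set} {B : A → Set} (xs : List A) (F : (a : A) → List (B a)) →
  Unique xs → (∀ a → Unique (F a)) → Unique (pairs xs F)
Unique-pairs xs F unique uniqueF = Unique-concatMap _ xs unique (λ a → map⁺ ,-injective (uniqueF a)) firsts-agree
  where
  ,-injective : ∀ {A : Set} {B : A → Set} {a : A} {y y′ : B a} → (Σ A B ∋ (a , y)) ≡ (a , y′) → y ≡ y′
  ,-injective refl = refl
  firsts-agree : ∀ a b {z} → z ∈ map (a ,_) (F a) → z ∈ map (b ,_) (F b) → a ≡ b
  firsts-agree a b z∈a z∈b with ∈-map⁻ (a ,_) z∈a | ∈-map⁻ (b ,_) z∈b
  ... | _ , _ , refl | _ , _ , refl = refl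

∈-pairs⁺ : {A : Set} {B : A → Set} (xs : List A) (F : (a : A) → List (B a)) {a : A} {y : B a} →
  a ∈ xs → y ∈ F a → (a , y) ∈ pairs xs F
∈-pairs⁺ xs F a∈xs y∈Fa = ∈-concatMap⁺ _ (lose a∈xs (∈-map⁺ (_ ,_) y∈Fa))

∈-pairs⁻ : {A : Set} {B : A → Set} (xs : List A) (F : (a : A) → List (B a)) {c : Σ A B} →
  c ∈ pairs xs F → proj₂ c ∈ F (proj₁ c)
∈-pairs⁻ xs F c∈ with find (∈-concatMap⁻ (λ a → map (a ,_) (F a)) {xs = xs} c∈)
... | a , _ , c∈a with ∈-map⁻ (a ,_) c∈a
...   | y , y∈Fa , refl = y∈Fa

length-pairs : {A : Set} {B : A → Set} (xs : List A) (F : (a : A) → List (B a)) →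
  length (pairs xs F) ≡ sum (map (length ∘ F) xs)
length-pairs [] F = refl
length-pairs {A} {B} (x ∷ xs) F =
  trans (length-++ (map (x ,_) (F x)) {pairs xs F})
        (cong₂ _+_ (length-map {A = B x} {B = Σ A B} (x ,_) (F x)) (length-pairs xs F))

sum-map-pairs : {A : Set} {B : A → Set} (g : Σ A B → ℕ) (xs : List A) (F : (a : A) → List (B a)) →
  sum (map g (pairs xs F)) ≡ sum (map (λ a → sum (map (λ y → g (a , y)) (F a))) xs)
sum-map-pairs g [] F = refl
sum-map-pairs g (x ∷ xs) F = trans (sum-map-++ g (map (x ,_) (F x)) (pairs xs F))
  (cong₂ _+_ (sum-map-∘ g (x ,_) (F x)) (sum-map-pairs g xs F))

length-filterᵇ : {A : Set} (p : A → Bool) (xs : List A) → length (filterᵇ p xs) ≡ boolCount p xs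
length-filterᵇ p [] = refl
length-filterᵇ p (x ∷ xs) with p x
... | true = cong suc (length-filterᵇ p xs)
... | false = length-filterᵇ p xs

Unique-map-injectiveOn : {A B : Set} (f : A → B) (xs : List A) → Unique xs →
  (∀ {x y} → x ∈ xs → y ∈ xs → f x ≡ f y → x ≡ y) → Unique (map f xs)
Unique-map-injectiveOn f [] _ _ = []
Unique-map-injectiveOn f (x ∷ xs) (x∉xs ∷ unique) injective =
  All.tabulate fx∉ ∷ Unique-map-injectiveOn f xs unique (λ p q → injective (there p) (there q))
  where
  fx∉ : ∀ {z} → z ∈ map f xs → ¬ f x ≡ z
  fx∉ z∈ e with ∈-map⁻ f z∈
  ... | y , y∈xs , refl = All.lookup x∉xs y∈xs (injective (here refl) (there y∈xs) e)

-- Codes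
occL : ∀ {ℓ} → Fin ℓ → List (Fin ℓ) → ℕ
occL b = boolCount (_== b)

isSurjectiveL : ∀ {ℓ} → List (Fin ℓ) → Bool
isSurjectiveL {ℓ} xs = allB (λ c → 1 ≤ᵇ occL c xs) (allFin ℓ)

isO₂L : ∀ {ℓ} → List (Fin (suc ℓ)) → Bool
isO₂L xs = isSurjectiveL xs ∧ (2 ≤ᵇ occL zero xs)

occ≡occL : ∀ {m ℓ} (b : Fin ℓ) (v : Vec (Fin ℓ) m) → occ b v ≡ occL b (toList v)
occ≡occL b V.[] = refl
occ≡occL b (x V.∷ v) = cong (ind (x == b) +_) (occ≡occL b v)

isSurjective≡isSurjectiveL : ∀ {m ℓ} (v : Vec (Fin ℓ) m) → isSurjective v ≡ isSurjectiveL (toList v)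
isSurjective≡isSurjectiveL {ℓ = ℓ} v = begin
  isSurjective v                            ≡⟨ allB-allFin ℓ _ ⟩
  every ℓ (λ c → 1 ≤ᵇ occ c v)              ≡⟨ every-cong ℓ (λ c → cong (1 ≤ᵇ_) (occ≡occL c v)) ⟩
  every ℓ (λ c → 1 ≤ᵇ occL c (toList v))    ≡⟨ allB-allFin ℓ _ ⟨
  isSurjectiveL (toList v)                  ∎
  where open ≡-Reasoning

isO₂≡isO₂L : ∀ {m ℓ} (v : Vec (Fin (suc ℓ)) m) → isO₂ zero v ≡ isO₂L (toList v)
isO₂≡isO₂L v = cong₂ _∧_ (isSurjective≡isSurjectiveL v) (cong (2 ≤ᵇ_) (occ≡occL zero v))

#words-isO₂L : ∀ m ℓ → #words isO₂L (allFin (suc ℓ)) m ≡ O₂ m (suc ℓ)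
#words-isO₂L m ℓ = trans (sym (boolCount-cong isO₂≡isO₂L (vectors (allFin (suc ℓ)) m)))
                         (cong (boolCount (isO₂ zero)) (sym (allFuns≡vectors m (suc ℓ))))

#words-isSurjectiveL : ∀ m ℓ → #words isSurjectiveL (allFin ℓ) m ≡ ℓ ! * S m ℓ
#words-isSurjectiveL m ℓ = begin
  #words isSurjectiveL (allFin ℓ) m
    ≡⟨ boolCount-cong isSurjective≡isSurjectiveL (vectors (allFin ℓ) m) ⟨
  boolCount isSurjective (vectors (allFin ℓ) m)
    ≡⟨ cong (boolCount isSurjective) (allFuns≡vectors m ℓ) ⟨
  #surjections m ℓ
    ≡⟨ #surjections≡ m ℓ ⟩
  ℓ ! * S m ℓ ∎
  where open ≡-Reasoning

isSurjectiveL-true⁻ : ∀ {ℓ} (xs : List (Fin ℓ)) → isSurjectiveL xs ≡ true → ∀ c → 1 ≤ occL c xs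
isSurjectiveL-true⁻ {ℓ} xs surj c = ≤ᵇ-true⁻ (every-true⁻ ℓ _ (trans (sym (allB-allFin ℓ _)) surj) c)

isSurjectiveL-true : ∀ {ℓ} (xs : List (Fin ℓ)) → (∀ c → 1 ≤ occL c xs) → isSurjectiveL xs ≡ true
isSurjectiveL-true {ℓ} xs hit = trans (allB-allFin ℓ _) (every-true ℓ _ (≤ᵇ-true ∘ hit))

_==⊎_ : ∀ {a c} → Fin a ⊎ Fin c → Fin a ⊎ Fin c → Bool
inj₁ x ==⊎ inj₁ y = x == y
inj₂ x ==⊎ inj₂ y = x == y
inj₁ _ ==⊎ inj₂ _ = false
inj₂ _ ==⊎ inj₁ _ = false

==⊎-true⁻ : ∀ {a c} {x y : Fin a ⊎ Fin c} → (x ==⊎ y) ≡ true → x ≡ y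
==⊎-true⁻ {x = inj₁ _} {inj₁ _} e = cong inj₁ (==-true⁻ e)
==⊎-true⁻ {x = inj₂ _} {inj₂ _} e = cong inj₂ (==-true⁻ e)

==⊎-refl : ∀ {a c} (x : Fin a ⊎ Fin c) → (x ==⊎ x) ≡ true
==⊎-refl (inj₁ a) = ==-refl a
==⊎-refl (inj₂ c) = ==-refl c

occL-lefts : ∀ {a c} (x : Fin a) (l : List (Fin a ⊎ Fin c)) → occL x (lefts l) ≡ boolCount (_==⊎ inj₁ x) l
occL-lefts x [] = refl
occL-lefts x (inj₁ y ∷ l) = cong (ind (y == x) +_) (occL-lefts x l)
occL-lefts x (inj₂ y ∷ l) = occL-lefts x l

occL-rights : ∀ {a c} (x : Fin c) (l : List (Fin a ⊎ Fin c)) → occL x (rights l) ≡ boolCount (_==⊎ inj₂ x) l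
occL-rights x [] = refl
occL-rights x (inj₁ y ∷ l) = occL-rights x l
occL-rights x (inj₂ y ∷ l) = cong (ind (y == x) +_) (occL-rights x l)

length-lefts : {A B : Set} (l : List (A ⊎ B)) → length (lefts l) ≡ boolCount isLeft l
length-lefts [] = refl
length-lefts (inj₁ x ∷ l) = cong suc (length-lefts l)
length-lefts (inj₂ x ∷ l) = length-lefts l

boolCount-toList : {A : Set} {n : ℕ} (p : A → Bool) (w : Vec A n) →
  boolCount p (toList w) ≡ ∑[ v < n ] ind (p (lookup w v))
boolCount-toList p V.[] = refl
boolCount-toList p (x V.∷ w) = cong (ind (p x) +_) (boolCount-toList p w)

∈-⊕-allFin : ∀ {a c} (x : Fin a ⊎ Fin c) → x ∈ allFin a ⊕ allFin c
∈-⊕-allFin {a} {c} (inj₁ y) = ∈-++⁺ˡ (∈-map⁺ inj₁ (∈-allFin y))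
∈-⊕-allFin {a} {c} (inj₂ y) = ∈-++⁺ʳ (map inj₁ (allFin a)) (∈-map⁺ inj₂ (∈-allFin y))

Unique-⊕-allFin : ∀ a c → Unique (allFin a ⊕ allFin c)
Unique-⊕-allFin a c = ++⁺ (map⁺ inj₁-injective (allFin⁺ a)) (map⁺ inj₂-injective (allFin⁺ c)) disjoint
  where
  disjoint : ∀ {v} → ¬ (v ∈ map inj₁ (allFin a) × v ∈ map inj₂ (allFin c))
  disjoint (p , q) with ∈-map⁻ inj₁ p | ∈-map⁻ inj₂ q
  ... | _ , _ , refl | _ , _ , ()

lefts-isSurjectiveL : ∀ {a c} (l : List (Fin a ⊎ Fin c)) → (∀ x → 1 ≤ boolCount (_==⊎ x) l) →
  isSurjectiveL (lefts l) ≡ true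
lefts-isSurjectiveL l hit = isSurjectiveL-true (lefts l) λ x → subst (1 ≤_) (sym (occL-lefts x l)) (hit (inj₁ x))

rights-isSurjectiveL : ∀ {a c} (l : List (Fin a ⊎ Fin c)) → (∀ x → 1 ≤ boolCount (_==⊎ x) l) →
  isSurjectiveL (rights l) ≡ true
rights-isSurjectiveL l hit = isSurjectiveL-true (rights l) λ x → subst (1 ≤_) (sym (occL-rights x l)) (hit (inj₂ x))

isSurjectiveL-hitsAll : ∀ {a c} (l : List (Fin a ⊎ Fin c)) →
  isSurjectiveL (lefts l) ≡ true → isSurjectiveL (rights l) ≡ true → ∀ x → 1 ≤ boolCount (_==⊎ x) l
isSurjectiveL-hitsAll l left right (inj₁ x) = subst (1 ≤_) (occL-lefts x l) (isSurjectiveL-true⁻ (lefts l) left x)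
isSurjectiveL-hitsAll l left right (inj₂ x) = subst (1 ≤_) (occL-rights x l) (isSurjectiveL-true⁻ (rights l) right x)

-- A code of shape sh for a threshold graph on [n] with d(G) = k assigns to every vertex its block.
module Codes (n k : ℕ) where

  dominatingSize : Bool → ℕ
  dominatingSize true = suc k
  dominatingSize false = k

  alphabet : (sh : Shape) → List (Block sh)
  alphabet (b , i , v) = allFin (suc i) ⊕ allFin (isolatedLevels (b , i , v))

  -- The first block (level 0) has the initial vertex and at least one more vertex.
  isCode : (sh : Shape) → List (Block sh) → Bool
  isCode (true , i , v) = splitsAs (suc k) isO₂L isSurjectiveL
  isCode (false , i , v) = splitsAs k isSurjectiveL isO₂L

  record IsValid (sh : Shape) (l : List (Block sh)) : Set where
    field
      length-lefts≡ : length (lefts l) ≡ dominatingSize (proj₁ sh)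
      hitsAll : ∀ x → 1 ≤ boolCount (_==⊎ x) l
      firstTwice : 2 ≤ boolCount (_==⊎ firstBlock sh) l

  isCode⇒IsValid : ∀ sh l → isCode sh l ≡ true → IsValid sh l
  isCode⇒IsValid (true , i , v) l e =
    let len , rest = ∧-true {length (lefts l) ≡ᵇ suc k} e
        o₂ , right = ∧-true {isO₂L (lefts l)} rest
        left , twice = ∧-true {isSurjectiveL (lefts l)} o₂
    in record { length-lefts≡ = ≡ᵇ-true⁻ len ; hitsAll = isSurjectiveL-hitsAll l left right
              ; firstTwice = subst (2 ≤_) (occL-lefts zero l) (≤ᵇ-true⁻ twice) }
  isCode⇒IsValid (false , i , v) l e =
    let len , rest = ∧-true {length (lefts l) ≡ᵇ k} e
        left , o₂ = ∧-true {isSurjectiveL (lefts l)} rest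
        right , twice = ∧-true {isSurjectiveL (rights l)} o₂
    in record { length-lefts≡ = ≡ᵇ-true⁻ len ; hitsAll = isSurjectiveL-hitsAll l left right
              ; firstTwice = subst (2 ≤_) (occL-rights zero l) (≤ᵇ-true⁻ twice) }

  IsValid⇒isCode : ∀ sh l → IsValid sh l → isCode sh l ≡ true
  IsValid⇒isCode (true , i , v) l record { length-lefts≡ = len ; hitsAll = hit ; firstTwice = twice }
    rewrite len | ≡ᵇ-refl k | lefts-isSurjectiveL l hit | rights-isSurjectiveL l hit
          | ≤ᵇ-true (subst (2 ≤_) (sym (occL-lefts zero l)) twice) = refl
  IsValid⇒isCode (false , i , v) l record { length-lefts≡ = len ; hitsAll = hit ; firstTwice = twice }
    rewrite len | ≡ᵇ-refl k | lefts-isSurjectiveL l hit | rights-isSurjectiveL l hit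
          | ≤ᵇ-true (subst (2 ≤_) (sym (occL-rights zero l)) twice) = refl

  #codes : Shape → ℕ
  #codes sh = #words (isCode sh) (alphabet sh) n

  #codes-dominatingRoot : ∀ i v → let ℓ = isolatedLevels (true , i , v) in
    #codes (true , i , v) ≡ (n C suc k) * O₂ (suc k) (suc i) * (ℓ ! * S (n ∸ suc k) ℓ)
  #codes-dominatingRoot i v =
    trans (#words-⊕ (allFin (suc i)) (allFin (isolatedLevels (true , i , v))) n (suc k) isO₂L isSurjectiveL)
          (cong₂ (λ a c → (n C suc k) * a * c) (#words-isO₂L (suc k) i) (#words-isSurjectiveL (n ∸ suc k) _))

  #codes-isolatedRoot : ∀ i v →
    #codes (false , i , v) ≡ (n C k) * (suc i ! * S k (suc i)) * O₂ (n ∸ k) (isolatedLevels (false , i , v))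
  #codes-isolatedRoot i v =
    trans (#words-⊕ (allFin (suc i)) (allFin (isolatedLevels (false , i , v))) n k isSurjectiveL isO₂L)
          (cong₂ (λ a c → (n C k) * a * c) (#words-isSurjectiveL k (suc i)) (#words-isO₂L (n ∸ k) _))

  #codes-term1 : ∀ i → #codes (true , i , false) + (#codes (true , i , true) + 0) ≡ term1 n k (suc i)
  #codes-term1 i = begin
    #codes (true , i , false) + (#codes (true , i , true) + 0)
      ≡⟨ cong₂ (λ x y → x + (y + 0)) (#codes-dominatingRoot i false) (#codes-dominatingRoot i true) ⟩
    A * B * X + (A * B * Y + 0)
      ≡⟨ factor A B X Y ⟩
    A * B * (X + Y)
      ≡⟨ cong₂ (λ m r → (n C m) * O₂ m (suc i) * (i ! * S r i + suc i ! * S r (suc i))) k+1≡1+k n∸k∸1≡n∸[1+k] ⟨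
    term1 n k (suc i) ∎
    where
    open ≡-Reasoning
    open +-*-Solver
    A = n C suc k
    B = O₂ (suc k) (suc i)
    X = i ! * S (n ∸ suc k) i
    Y = suc i ! * S (n ∸ suc k) (suc i)
    k+1≡1+k = +-comm k 1
    n∸k∸1≡n∸[1+k] = trans (∸-+-assoc n k 1) (cong (n ∸_) k+1≡1+k)
    factor : ∀ a b x y → a * b * x + (a * b * y + 0) ≡ a * b * (x + y)
    factor = solve 4 (λ a b x y → a :* b :* x :+ (a :* b :* y :+ con 0) := a :* b :* (x :+ y)) refl

  #codes-term2 : ∀ i → #codes (false , i , true) + (#codes (false , i , false) + 0) ≡ term2 n k (suc i)
  #codes-term2 i = begin
    #codes (false , i , true) + (#codes (false , i , false) + 0)
      ≡⟨ cong₂ (λ x y → x + (y + 0)) (#codes-isolatedRoot i true) (#codes-isolatedRoot i false) ⟩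
    A * (F * Z) * X + (A * (F * Z) * Y + 0)
      ≡⟨ factor A F Z X Y ⟩
    A * F * Z * (X + Y)
      ≡⟨ cong (λ m → A * F * Z * (O₂ (n ∸ k) m + Y)) (+-comm (suc i) 1) ⟨
    term2 n k (suc i) ∎
    where
    open ≡-Reasoning
    open +-*-Solver
    A = n C k
    F = suc i !
    Z = S k (suc i)
    X = O₂ (n ∸ k) (suc (suc i))
    Y = O₂ (n ∸ k) (suc i)
    factor : ∀ a f z x y → a * (f * z) * x + (a * (f * z) * y + 0) ≡ a * f * z * (x + y)
    factor = solve 5 (λ a f z x y → a :* (f :* z) :* x :+ (a :* (f :* z) :* y :+ con 0) := a :* f :* z :* (x :+ y)) refl

  N : ℕ
  N = n + k + 1

  variants : Bool → List Bool
  variants true = false ∷ true ∷ []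
  variants false = true ∷ false ∷ []

  shapes : List Shape
  shapes = pairs (true ∷ false ∷ []) (λ b → pairs (upTo N) (λ _ → variants b))

  codesOf : (sh : Shape) → List (Vec (Block sh) n)
  codesOf sh = filterᵇ (isCode sh ∘ toList) (vectors (alphabet sh) n)

  Code : Set
  Code = Σ Shape λ sh → Vec (Block sh) n

  codes : List Code
  codes = pairs shapes codesOf

  length-codes : length codes ≡ formula n k
  length-codes = begin
    length codes
      ≡⟨ length-pairs shapes codesOf ⟩
    sum (map (length ∘ codesOf) shapes)
      ≡⟨ sum-map-cong (λ sh → length-filterᵇ (isCode sh ∘ toList) (vectors (alphabet sh) n)) shapes ⟩
    sum (map #codes shapes)
      ≡⟨ sum-map-pairs #codes (true ∷ false ∷ []) (λ b → pairs (upTo N) (λ _ → variants b)) ⟩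
    sum (map (λ b → sum (map (λ y → #codes (b , y)) (pairs (upTo N) (λ _ → variants b)))) (true ∷ false ∷ []))
      ≡⟨ sum-map-cong (λ b → sum-map-pairs (λ y → #codes (b , y)) (upTo N) (λ _ → variants b)) (true ∷ false ∷ []) ⟩
    sum (map (λ i → #codes (true , i , false) + (#codes (true , i , true) + 0)) (upTo N))
      + (sum (map (λ i → #codes (false , i , true) + (#codes (false , i , false) + 0)) (upTo N)) + 0)
      ≡⟨ cong₂ _+_ (sum-map-cong #codes-term1 (upTo N)) (trans (+-identityʳ _) (sum-map-cong #codes-term2 (upTo N))) ⟩
    formula n k ∎
    where open ≡-Reasoning

  levelsOf : (sh : Shape) → Vec (Block sh) n → Fin n → ℕ
  levelsOf sh w v = blockLevel sh (lookup w v)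

  graphOf : Code → Graph n
  graphOf (sh , w) = levelGraph (proj₁ sh) (levelsOf sh w)

  graphs : List (Graph n)
  graphs = map graphOf codes

  dominatingCount-levelsOf : ∀ sh (w : Vec (Block sh) n) →
    dominatingCount (proj₁ sh) (levelsOf sh w) ≡ length (lefts (toList w))
  dominatingCount-levelsOf sh w = begin
    ∑[ v < n ] ind (levelType (proj₁ sh) (levelsOf sh w v))
      ≡⟨ ∑-cong (λ v → cong ind (levelType-blockLevel sh (lookup w v))) ⟩
    ∑[ v < n ] ind (isLeft (lookup w v))                   ≡⟨ boolCount-toList isLeft w ⟨
    boolCount isLeft (toList w)                            ≡⟨ length-lefts (toList w) ⟨
    length (lefts (toList w))                              ∎
    where open ≡-Reasoning

  dominatingSize≡ : ∀ b → dominatingSize b ≡ k + ind b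
  dominatingSize≡ true = +-comm 1 k
  dominatingSize≡ false = sym (+-identityʳ k)

  module ValidCode (sh : Shape) (w : Vec (Block sh) n) (valid : IsValid sh (toList w)) where
    open IsValid valid

    vertexInBlock : ∀ x → Σ (Fin n) λ v → lookup w v ≡ x
    vertexInBlock x = let v , v∈x = ∑-ind-witness n _ (subst (1 ≤_) (boolCount-toList (_==⊎ x) w) (hitsAll x))
                      in v , ==⊎-true⁻ v∈x

    canonical : Canonical (levelsOf sh w)
    canonical = record
      { gapless = λ v j j<l → let x , x≡j = blockAtLevel sh j (<-trans j<l (blockLevel-< sh (lookup w v)))
                                  u , u∈x = vertexInBlock x
                              in u , trans (cong (blockLevel sh) u∈x) x≡j
      ; root₁ = r₁
      ; root₂ = r₂
      ; root₁≢root₂ = r₁≢r₂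
      ; root₁-level = trans (cong (blockLevel sh) (==⊎-true⁻ {x = lookup w r₁} r₁∈first)) (blockLevel-firstBlock sh)
      ; root₂-level = trans (cong (blockLevel sh) (==⊎-true⁻ {x = lookup w r₂} r₂∈first)) (blockLevel-firstBlock sh)
      }
      where
      roots = ∑-ind-two-witnesses n (λ v → lookup w v ==⊎ firstBlock sh)
                (subst (2 ≤_) (boolCount-toList (_==⊎ firstBlock sh) w) firstTwice)
      r₁ = proj₁ roots
      r₂ = proj₁ (proj₂ roots)
      r₁≢r₂ = proj₁ (proj₂ (proj₂ roots))
      r₁∈first = proj₁ (proj₂ (proj₂ (proj₂ roots)))
      r₂∈first = proj₂ (proj₂ (proj₂ (proj₂ roots)))

    dominatingCount≡ : dominatingCount (proj₁ sh) (levelsOf sh w) ≡ k + ind (proj₁ sh)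
    dominatingCount≡ = trans (dominatingCount-levelsOf sh w) (trans length-lefts≡ (dominatingSize≡ (proj₁ sh)))

    topVertex : Σ (Fin n) λ v → suc (levelsOf sh w v) ≡ levelCount sh
    topVertex = go (levelCount sh) refl (≤-<-trans z≤n (dominatingLevels<levelCount sh))
      where
      go : ∀ L → levelCount sh ≡ L → 0 < L → Σ (Fin n) λ v → suc (levelsOf sh w v) ≡ levelCount sh
      go (suc M) L≡ _ = let x , x≡M = blockAtLevel sh M (≤-reflexive (sym L≡))
                            v , v∈x = vertexInBlock x
                        in v , trans (cong (suc ∘ blockLevel sh) v∈x) (trans (cong suc x≡M) (sym L≡))

  codes-valid : ∀ {c} → c ∈ codes → IsValid (proj₁ c) (toList (proj₂ c))
  codes-valid {sh , w} c∈ = isCode⇒IsValid sh (toList w) (Equivalence.to T-≡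
    (proj₂ (∈-filter⁻ (T? ∘ (isCode sh ∘ toList)) {xs = vectors (alphabet sh) n} (∈-pairs⁻ shapes codesOf c∈))))

  graphs-sound : ∀ g → g ∈ graphs → ThresholdWithD n k g
  graphs-sound g g∈ with ∈-map⁻ graphOf g∈
  ... | (sh , w) , c∈ , refl =
    F.σ , F.t , F.buildGraph≡levelGraph ,
    +-cancelʳ-≡ (ind b) _ _ (trans F.domCount≡ (ValidCode.dominatingCount≡ sh w valid))
    where
    valid = codes-valid c∈
    b = proj₁ sh
    module F = FromLevels b (levelsOf sh w) (ValidCode.canonical sh w valid)

  Unique-shapes : Unique shapes
  Unique-shapes = Unique-pairs (true ∷ false ∷ []) _ (((λ ()) ∷ []) ∷ [] ∷ [])
    (λ b → Unique-pairs (upTo N) (λ _ → variants b) (upTo⁺ N) (λ _ → Unique-variants b))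
    where
    Unique-variants : ∀ b → Unique (variants b)
    Unique-variants true = ((λ ()) ∷ []) ∷ [] ∷ []
    Unique-variants false = ((λ ()) ∷ []) ∷ [] ∷ []

  Unique-codes : Unique codes
  Unique-codes = Unique-pairs shapes codesOf Unique-shapes λ sh@(b , i , v) →
    filter⁺ (T? ∘ (isCode sh ∘ toList))
            (Unique-vectors (alphabet sh) n (Unique-⊕-allFin (suc i) (isolatedLevels sh)))

  -- The number of levels, hence the shape, is read off from the top level.
  sameLevels⇒≡ : ∀ b i v i′ v′ (w : Vec (Block (b , i , v)) n) (w′ : Vec (Block (b , i′ , v′)) n) →
    IsValid (b , i , v) (toList w) → IsValid (b , i′ , v′) (toList w′) →
    (∀ u → levelsOf (b , i , v) w u ≡ levelsOf (b , i′ , v′) w′ u) →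
    (Code ∋ ((b , i , v) , w)) ≡ ((b , i′ , v′) , w′)
  sameLevels⇒≡ b i v i′ v′ w w′ valid valid′ same =
    finish (levelCount-injective b i v i′ v′ L≡L′) w′ same
    where
    L≤L′ : ∀ sh sh′ (w : Vec (Block sh) n) (w′ : Vec (Block sh′) n) → IsValid sh (toList w) →
      (∀ u → levelsOf sh w u ≡ levelsOf sh′ w′ u) → levelCount sh ≤ levelCount sh′
    L≤L′ sh sh′ w w′ valid same = let u , top = ValidCode.topVertex sh w valid in
      subst (_≤ levelCount sh′) top
            (subst (λ l → suc l ≤ levelCount sh′) (sym (same u)) (blockLevel-< sh′ (lookup w′ u)))
    L≡L′ : levelCount (b , i , v) ≡ levelCount (b , i′ , v′)
    L≡L′ = ≤-antisym (L≤L′ (b , i , v) (b , i′ , v′) w w′ valid same)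
                     (L≤L′ (b , i′ , v′) (b , i , v) w′ w valid′ (sym ∘ same))
    finish : ∀ {i′ v′} → i ≡ i′ × v ≡ v′ → (w′ : Vec (Block (b , i′ , v′)) n) →
      (∀ u → levelsOf (b , i , v) w u ≡ levelsOf (b , i′ , v′) w′ u) →
      (Code ∋ ((b , i , v) , w)) ≡ ((b , i′ , v′) , w′)
    finish (refl , refl) w′ same = cong ((b , i , v) ,_)
      (trans (sym (tabulate∘lookup w))
             (trans (tabulate-cong λ u → blockLevel-injective (b , i , v) (same u)) (tabulate∘lookup w′)))

  graphOf-injective : ∀ {c c′} → c ∈ codes → c′ ∈ codes → graphOf c ≡ graphOf c′ → c ≡ c′
  graphOf-injective {(b , i , v) , w} {(b′ , i′ , v′) , w′} c∈ c′∈ eq =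
    sameGraph (levelGraph-injective {b = b} {b′} {levelsOf (b , i , v) w} {levelsOf (b′ , i′ , v′) w′}
                (ValidCode.canonical (b , i , v) w (codes-valid c∈))
                (ValidCode.canonical (b′ , i′ , v′) w′ (codes-valid c′∈)) eq)
    where
    sameGraph : b ≡ b′ × (∀ u → levelsOf (b , i , v) w u ≡ levelsOf (b′ , i′ , v′) w′ u) →
                (Code ∋ ((b , i , v) , w)) ≡ ((b′ , i′ , v′) , w′)
    sameGraph (refl , same) = sameLevels⇒≡ b i v i′ v′ w w′ (codes-valid c∈) (codes-valid c′∈) same

  Unique-graphs : Unique graphs
  Unique-graphs = Unique-map-injectiveOn graphOf codes Unique-codes graphOf-injective

  module FromCanonical (b : Bool) (h : Fin n → ℕ) (canon : Canonical h) (h<n : ∀ u → h u < n)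
                       (dominating : dominatingCount b h ≡ k + ind b)
                       (top : Fin n) (top-max : ∀ u → h u ≤ h top)
                       (i : ℕ) (v : Bool) (levelCount≡ : levelCount (b , i , v) ≡ suc (h top)) where
    open Canonical canon

    sh : Shape
    sh = (b , i , v)

    vertexAtLevel : ∀ j → j ≤ h top → Σ (Fin n) λ u → h u ≡ j
    vertexAtLevel j j≤ with m≤n⇒m<n∨m≡n j≤
    ... | inj₁ j< = gapless top j j<
    ... | inj₂ j≡ = top , sym j≡

    block : Fin n → Block sh
    block u = proj₁ (blockAtLevel sh (h u) (subst (h u <_) (sym levelCount≡) (s≤s (top-max u))))

    w : Vec (Block sh) n
    w = V.tabulate block

    levelsOf-w : ∀ u → levelsOf sh w u ≡ h u
    levelsOf-w u = trans (cong (blockLevel sh) (lookup∘tabulate block u))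
                         (proj₂ (blockAtLevel sh (h u) (subst (h u <_) (sym levelCount≡) (s≤s (top-max u)))))

    lookup-w : ∀ u x → h u ≡ blockLevel sh x → lookup w u ≡ x
    lookup-w u x e = blockLevel-injective sh (trans (levelsOf-w u) e)

    valid : IsValid sh (toList w)
    valid = record { length-lefts≡ = length-lefts≡ ; hitsAll = hitsAll ; firstTwice = firstTwice }
      where
      length-lefts≡ : length (lefts (toList w)) ≡ dominatingSize b
      length-lefts≡ = begin
        length (lefts (toList w))     ≡⟨ dominatingCount-levelsOf sh w ⟨
        dominatingCount b (levelsOf sh w) ≡⟨ ∑-cong (λ u → cong (ind ∘ levelType b) (levelsOf-w u)) ⟩
        dominatingCount b h           ≡⟨ dominating ⟩
        k + ind b                     ≡⟨ dominatingSize≡ b ⟨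
        dominatingSize b              ∎
        where open ≡-Reasoning
      hitsAll : ∀ x → 1 ≤ boolCount (_==⊎ x) (toList w)
      hitsAll x = subst (1 ≤_) (sym (boolCount-toList (_==⊎ x) w))
                    (∑-ind-≥1 n (λ u → lookup w u ==⊎ x) u
                      (subst (λ y → (y ==⊎ x) ≡ true) (sym (lookup-w u x hu≡)) (==⊎-refl x)))
        where
        atLevel = vertexAtLevel (blockLevel sh x) (s≤s⁻¹ (subst (blockLevel sh x <_) levelCount≡ (blockLevel-< sh x)))
        u = proj₁ atLevel
        hu≡ = proj₂ atLevel
      root∈first : ∀ u → h u ≡ 0 → (lookup w u ==⊎ firstBlock sh) ≡ true
      root∈first u hu≡0 = subst (λ y → (y ==⊎ firstBlock sh) ≡ true)
        (sym (lookup-w u (firstBlock sh) (trans hu≡0 (sym (blockLevel-firstBlock sh))))) (==⊎-refl (firstBlock sh))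
      firstTwice : 2 ≤ boolCount (_==⊎ firstBlock sh) (toList w)
      firstTwice = subst (2 ≤_) (sym (boolCount-toList (_==⊎ firstBlock sh) w))
        (∑-ind-≥2 n (λ u → lookup w u ==⊎ firstBlock sh) root₁ root₂ root₁≢root₂
          (root∈first root₁ root₁-level) (root∈first root₂ root₂-level))

    sh∈shapes : sh ∈ shapes
    sh∈shapes = ∈-pairs⁺ (true ∷ false ∷ []) (λ b → pairs (upTo N) (λ _ → variants b)) (b∈ b)
                  (∈-pairs⁺ (upTo N) (λ _ → variants b) (∈-upTo⁺ i<N) (v∈ b v))
      where
      b∈ : ∀ b → b ∈ true ∷ false ∷ []
      b∈ true = here refl
      b∈ false = there (here refl)
      v∈ : ∀ b v → v ∈ variants b
      v∈ true false = here refl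
      v∈ true true = there (here refl)
      v∈ false true = here refl
      v∈ false false = there (here refl)
      i<N : i < N
      i<N = begin-strict
        i              <⟨ dominatingLevels<levelCount sh ⟩
        levelCount sh  ≡⟨ levelCount≡ ⟩
        suc (h top)    ≤⟨ h<n top ⟩
        n              ≤⟨ m≤m+n n k ⟩
        n + k          ≤⟨ m≤m+n (n + k) 1 ⟩
        N              ∎
        where open ≤-Reasoning

    w∈codesOf : w ∈ codesOf sh
    w∈codesOf = ∈-filter⁺ (T? ∘ (isCode sh ∘ toList)) (∈-vectors (alphabet sh) w (λ u → ∈-⊕-allFin (lookup w u)))
                  (Equivalence.from T-≡ (IsValid⇒isCode sh (toList w) valid))

    levelGraph∈graphs : levelGraph b h ∈ graphs
    levelGraph∈graphs = subst (_∈ graphs) (levelGraph-cong b levelsOf-w)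
                          (∈-map⁺ graphOf (∈-pairs⁺ shapes codesOf sh∈shapes w∈codesOf))

  module Complete (2≤n : 2 ≤ n) (1≤k : 1 ≤ k) (σ : Permutation′ n) (t : Fin n → Bool)
                  (domCount≡k : domCount t ≡ k) where
    open ToLevels σ t 2≤n

    dominating : dominatingCount b h ≡ k + ind b
    dominating = trans (sym domCount≡) (cong (_+ ind b) domCount≡k)

    top : Σ (Fin n) λ m → ∀ u → h u ≤ h m
    top = argmax h (vertexAt 0 0<n)

    -- Since k ≥ 1 some vertex is dominating, and when b = false it lies above level 0.
    nonempty : b ≡ false → 1 ≤ h (proj₁ top)
    nonempty b≡false = ≤-trans (positive (h u) dominatingU) (proj₂ top u)
      where
      dominatingCount≡k : dominatingCount b h ≡ k
      dominatingCount≡k = trans dominating (trans (cong (λ c → k + ind c) b≡false) (+-identityʳ k))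
      witness = ∑-ind-witness n (λ u → levelType b (h u)) (subst (1 ≤_) (sym dominatingCount≡k) 1≤k)
      u = proj₁ witness
      dominatingU = proj₂ witness
      positive : ∀ j → levelType b j ≡ true → 1 ≤ j
      positive zero bj = contradiction (trans (sym b≡false) bj) λ ()
      positive (suc j) _ = s≤s z≤n

    buildGraph∈graphs : buildGraph σ t ∈ graphs
    buildGraph∈graphs with shapeWithLevelCount b (h (proj₁ top)) nonempty
    ... | i , v , levelCount≡ = subst (_∈ graphs) (sym buildGraph≡levelGraph)
      (FromCanonical.levelGraph∈graphs b h canon h<n dominating (proj₁ top) (proj₂ top) i v levelCount≡)

  graphs-complete : 2 ≤ n → 1 ≤ k → ∀ g → ThresholdWithD n k g → g ∈ graphs
  graphs-complete 2≤n 1≤k g (σ , t , refl , domCount≡k) = Complete.buildGraph∈graphs 2≤n 1≤k σ t domCount≡k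

  thresholdGraphs-count : 2 ≤ n → 1 ≤ k → HasCount (ThresholdWithD n k) (formula n k)
  thresholdGraphs-count 2≤n 1≤k =
    graphs , Unique-graphs , trans (length-map graphOf codes) length-codes ,
    λ g → mk⇔ (graphs-sound g) (graphs-complete 2≤n 1≤k g)

-- Degenerate cases
emptyGraph : ∀ n → Graph n
emptyGraph n = V.tabulate λ _ → V.tabulate λ _ → false

boolCount≡0⇒false : {A : Set} (p : A → Bool) (xs : List A) → boolCount p xs ≡ 0 → ∀ {x} → x ∈ xs → p x ≡ false
boolCount≡0⇒false p (y ∷ xs) count≡0 x∈ with p y in py
boolCount≡0⇒false p (y ∷ xs) count≡0 (here refl) | false = py
boolCount≡0⇒false p (y ∷ xs) count≡0 (there x∈) | false = boolCount≡0⇒false p xs count≡0 x∈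

domCount≡0⇒isolated : ∀ {n} (t : Fin n → Bool) → domCount t ≡ 0 → ∀ p → ¬ toℕ p ≡ 0 → t p ≡ false
domCount≡0⇒isolated {n} t count≡0 p p≢0 = trans (sym (∧-identityʳ (t p)))
  (subst (λ c → t p ∧ not c ≡ false) (≡ᵇ-false p≢0) (boolCount≡0⇒false _ (allFin n) count≡0 (∈-allFin p)))

buildGraph-isolated : ∀ {n} (σ : Permutation′ n) (t : Fin n → Bool) → (∀ p → ¬ toℕ p ≡ 0 → t p ≡ false) →
  buildGraph σ t ≡ emptyGraph n
buildGraph-isolated σ t isolated = tabulate-cong λ u → tabulate-cong λ v → adjPos-isolated (σ ⟨$⟩ˡ u) (σ ⟨$⟩ˡ v)
  where
  adjPos-isolated : ∀ i j → adjPos t i j ≡ false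
  adjPos-isolated i j with toℕ i <ᵇ toℕ j in i<j
  ... | true = isolated j (m<n⇒n≢0 (<ᵇ-true⁻ i<j))
  ... | false with toℕ j <ᵇ toℕ i in j<i
  ...   | true = isolated i (m<n⇒n≢0 (<ᵇ-true⁻ j<i))
  ...   | false = refl

noDominating-count : ∀ n → HasCount (ThresholdWithD n 0) 1
noDominating-count n = emptyGraph n ∷ [] , [] ∷ [] , refl , λ g → mk⇔ (sound g) (complete g)
  where
  sound : ∀ g → g ∈ emptyGraph n ∷ [] → ThresholdWithD n 0 g
  sound g (here refl) = Permutation.id , (λ _ → false) , buildGraph-isolated Permutation.id _ (λ _ _ → refl)
                      , boolCount-false _ (λ _ → refl) (allFin n)
  complete : ∀ g → ThresholdWithD n 0 g → g ∈ emptyGraph n ∷ []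
  complete g (σ , t , refl , count≡0) = here (buildGraph-isolated σ t (domCount≡0⇒isolated t count≡0))

twoVertices-count : ∀ k → 2 ≤ k → HasCount (ThresholdWithD 2 k) 0
twoVertices-count k 2≤k = [] , [] , refl , λ g → mk⇔ (λ ()) λ (σ , t , _ , count≡k) →
  contradiction (subst (_≤ 1) count≡k (domCount≤1 t)) (<⇒≱ 2≤k)
  where
  domCount≤1 : (t : Fin 2 → Bool) → domCount t ≤ 1
  domCount≤1 t = ≤-trans (≤-reflexive (domCount-suc t)) (+-monoˡ-≤ 0 (ind≤1 (t (suc zero))))

mainTheorem3 : ((n : ℕ) → 1 ≤ n → HasCount (ThresholdWithD n 0) 1)
    × HasCount (ThresholdWithD 2 1) 1
    × ((k : ℕ) → 2 ≤ k → HasCount (ThresholdWithD 2 k) 0)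
    × ((n k : ℕ) → 3 ≤ n → 1 ≤ k → HasCount (ThresholdWithD n k) (formula n k))
mainTheorem3 =
  (λ n _ → noDominating-count n) ,
  -- formula 2 1 evaluates to 1.
  Codes.thresholdGraphs-count 2 1 ≤-refl ≤-refl ,
  twoVertices-count ,
  λ n k 3≤n 1≤k → Codes.thresholdGraphs-count n k (≤-trans (n≤1+n 2) 3≤n) 1≤k
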